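{- Let $n, k \in \mathbf{N}$ with $n/2 < k \le n$. Then $K(n,k) = 2(n-k) - B(n-k)$.
   Context: The $k$-majority game is played with $n$ numbered balls, each coloured with one of two colours, where it is given that at least $k$ balls have the majority colour (here $k > n/2$ is fixed). On each turn the player selects two balls to compare, and it is revealed whether they have the same colour or different colours. The player's aim is to identify a ball of the majority colour. $K(n,k)$ denotes the minimum number of comparisons that guarantees success (against any colouring consistent with the given information). For $m \in \mathbf{N}_0$, $B(m)$ denotes the number of digits $1$ in the binary expansion of $m$. -}

module Defs where

open import Data.Nat using (ℕ; zero; suc; _+_; _∸_; _*_; _≤_; _<_; _⊔_)
open import Data.Nat.DivMod using (_/_; _%_)
open import Data.Bool using (Bool; true; false; if_then_else_)
open import Data.Bool.Properties using () renaming (_≟_ to _≟ᵇ_)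
open import Data.Fin using (Fin)
import Data.Fin as F
open import Data.Sum using (_⊎_)
open import Data.Product using (Σ; _×_)
open import Relation.Nullary using (does)

Colouring : ℕ → Set
Colouring n = Fin n → Bool

count : ∀ {n} → Colouring n → Bool → ℕ
count {zero}  c b = 0
count {suc n} c b = (if does (c F.zero ≟ᵇ b) then 1 else 0) + count (λ i → c (F.suc i)) b

Valid : ℕ → ∀ {n} → Colouring n → Set
Valid k c = (k ≤ count c true) ⊎ (k ≤ count c false)

-- Adaptive comparison strategy (decision tree): either announce a ball,
-- or compare balls i and j and continue according to the answer.
data Strategy (n : ℕ) : Set where
  answer  : Fin n → Strategy n
  compare : Fin n → Fin n → (ifSame ifDiff : Strategy n) → Strategy n

depth : ∀ {n} → Strategy n → ℕ
depth (answer _) = 0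
depth (compare _ _ s d) = suc (depth s ⊔ depth d)

run : ∀ {n} → Strategy n → Colouring n → Fin n
run (answer a) c = a
run (compare i j s d) c = if does (c i ≟ᵇ c j) then run s c else run d c

Wins : ℕ → ∀ {n} → Strategy n → Set
Wins k {n} s = (c : Colouring n) → Valid k c → k ≤ count c (c (run s c))

-- K(n,k) = m : some winning strategy uses ≤ m comparisons, and every
-- winning strategy needs ≥ m comparisons in the worst case.
IsK : (n k m : ℕ) → Set
IsK n k m = (Σ (Strategy n) λ s → (Wins k s × (depth s ≤ m)))
          × ((s : Strategy n) → Wins k s → m ≤ depth s)

-- B-aux fuel m : sum of binary digits of m (fuel ≥ number of digits)
B-aux : ℕ → ℕ → ℕ
B-aux zero    m = 0
B-aux (suc f) m = m % 2 + B-aux f (m / 2)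

B : ℕ → ℕ
B m = B-aux m m

-- Upper bound: compare the first 2q + 1 balls (q = n − k) in pairs and keep one ball of every
-- equal pair; the survivors, with a leftover ball as tie-breaker, carry the same strict majority,
-- so recursing costs p + T ⌊p/2⌋ = T p = 2p − B p comparisons for p pairs.
--
-- Lower bound (polynomial method): put t = k − q − 1 and f r = (−1)^r (r − q − 1 choose t), an
-- alternating polynomial of degree t. Sum f(#true balls) over all colourings on which a strategy
-- announces a false ball. For a winning strategy the sum is ±(2q choose q), whose 2-adic valuation
-- is B q (Kummer). Along the decision tree the colourings consistent with the answers split into
-- components of known relative colour; summing f of a linear form over the 2^ℓ colourings of ℓ free
-- components gives a multiple of 2^(ℓ − t), and each comparison loses at most one factor 2. Hence a
-- strategy of depth d has 2^(2q − d) dividing (2q choose q), i.e. d ≥ 2q − B q.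

module Submission where

open import Data.Nat.Base as ℕ using (ℕ; zero; suc; _≤_; _<_; z≤n; s≤s; z<s; ⌊_/2⌋)
open import Data.Bool.Base using (Bool; true; false; not; if_then_else_; _xor_)
open import Data.Bool.Properties using (¬-not) renaming (_≟_ to _≟ᵇ_)
open import Data.Fin.Base using (Fin) renaming (zero to fzero; suc to fsuc)
open import Data.List.Base using (List; []; _∷_; length; take; tabulate)
open import Data.Product.Base using (∃; ∃-syntax; Σ; _×_; _,_; proj₁; proj₂)
open import Data.Sum.Base using (_⊎_; inj₁; inj₂; [_,_]′)
open import Function.Base using (_∘_; id; _$_)
open import Relation.Nullary using (¬_; does; yes; no; contradiction)
open import Relation.Binary.PropositionalEquality
open import Defs

module BinaryDigits where
  open import Data.Nat.Base using (_+_; _*_)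
  open import Data.Nat.DivMod using (_/_; _%_; m*n%n≡0; [m+kn]%n≡m%n; m*n/n≡m; m/n<m; +-distrib-/-∣ʳ)
  open import Data.Nat.Divisibility using (n∣m*n)
  open import Data.Nat.Properties
  open import Data.Nat.Induction using (<-rec)

  even-or-odd : ∀ x → ∃[ y ] (x ≡ y * 2 ⊎ x ≡ suc (y * 2))
  even-or-odd zero = 0 , inj₁ refl
  even-or-odd (suc x) with even-or-odd x
  ... | y , inj₁ refl = y , inj₂ refl
  ... | y , inj₂ refl = suc y , inj₁ refl

  private
    half<suc : ∀ m → suc m / 2 < suc m
    half<suc m = m/n<m (suc m) 2 (s≤s (s≤s z≤n))

    B-aux-fuel : ∀ f f′ {m} → m ≤ f → m ≤ f′ → B-aux f m ≡ B-aux f′ m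
    B-aux-fuel zero    zero     z≤n z≤n = refl
    B-aux-fuel zero    (suc f′) z≤n _   = B-aux-fuel zero f′ z≤n z≤n
    B-aux-fuel (suc f) zero     _   z≤n = B-aux-fuel f zero z≤n z≤n
    B-aux-fuel (suc f) (suc f′) {m} m≤f m≤f′ = cong (m % 2 +_) (B-aux-fuel f f′ (half≤ m m≤f) (half≤ m m≤f′))
      where
      half≤ : ∀ m {f} → m ≤ suc f → m / 2 ≤ f
      half≤ zero    _  = z≤n
      half≤ (suc m) m≤ = ≤-pred (≤-trans (half<suc m) m≤)

  B-unfold : ∀ m → B m ≡ m % 2 + B (m / 2)
  B-unfold zero    = refl
  B-unfold (suc m) = cong (suc m % 2 +_) (B-aux-fuel m (suc m / 2) (≤-pred (half<suc m)) ≤-refl)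

  B-double : ∀ h → B (h * 2) ≡ B h
  B-double h = begin
    B (h * 2)                     ≡⟨ B-unfold (h * 2) ⟩
    h * 2 % 2 + B (h * 2 / 2)     ≡⟨ cong₂ _+_ (m*n%n≡0 h 2) (cong B (m*n/n≡m h 2)) ⟩
    B h                           ∎
    where open ≡-Reasoning

  B-double+1 : ∀ h → B (suc (h * 2)) ≡ suc (B h)
  B-double+1 h = begin
    B (suc (h * 2))                       ≡⟨ B-unfold (suc (h * 2)) ⟩
    suc (h * 2) % 2 + B (suc (h * 2) / 2) ≡⟨ cong₂ _+_ ([m+kn]%n≡m%n 1 h 2) (cong B half) ⟩
    suc (B h)                             ∎
    where
    open ≡-Reasoning
    half : suc (h * 2) / 2 ≡ h
    half = trans (+-distrib-/-∣ʳ 1 {d = 2} (n∣m*n h)) (m*n/n≡m h 2)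

  B≤ : ∀ m → B m ≤ m
  B≤ = <-rec _ go
    where
    go : ∀ m → (∀ {y} → y < m → B y ≤ y) → B m ≤ m
    go m rec with even-or-odd m
    ... | zero  , inj₁ refl = z≤n
    ... | suc y , inj₁ refl = begin
      B (suc y * 2) ≡⟨ B-double (suc y) ⟩
      B (suc y)     ≤⟨ rec (m<m*n (suc y) 2 (s≤s (s≤s z≤n))) ⟩
      suc y         ≤⟨ m≤m*n (suc y) 2 ⟩
      suc y * 2     ∎
      where open ≤-Reasoning
    ... | y , inj₂ refl = begin
      B (suc (y * 2)) ≡⟨ B-double+1 y ⟩
      suc (B y)       ≤⟨ s≤s (rec (s≤s (m≤m*n y 2))) ⟩
      suc y           ≤⟨ s≤s (m≤m*n y 2) ⟩
      suc (y * 2)     ∎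
      where open ≤-Reasoning

module TwoAdicValuation where
  open import Data.Nat.Base using (_+_; _*_; _^_)
  open import Data.Nat.Properties
  open import Data.Nat.Induction using (<-rec)
  open import Data.Nat.Divisibility using (_∣_; divides)
  open import Data.Nat.Tactic.RingSolver using (solve-∀)
  open BinaryDigits

  Odd : ℕ → Set
  Odd o = ∃[ r ] o ≡ suc (r * 2)

  record Val₂ (x v : ℕ) : Set where
    constructor val₂
    field
      oddPart       : ℕ
      odd           : Odd oddPart
      factorisation : x ≡ 2 ^ v * oddPart

  odd≢even : ∀ r u → suc (r * 2) ≢ u * 2
  odd≢even zero    zero    ()
  odd≢even zero    (suc u) ()
  odd≢even (suc r) zero    ()
  odd≢even (suc r) (suc u) e = odd≢even r u (suc-injective (suc-injective e))

  private
    double-assoc : ∀ p o → 2 * p * o ≡ p * o * 2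
    double-assoc = solve-∀

    shift : ∀ u p → u * (2 * p) ≡ u * p * 2
    shift = solve-∀

  val₂-exists : ∀ x → 0 < x → ∃ (Val₂ x)
  val₂-exists = <-rec _ go
    where
    go : ∀ x → (∀ {y} → y < x → 0 < y → ∃ (Val₂ y)) → 0 < x → ∃ (Val₂ x)
    go x rec x>0 with even-or-odd x
    ... | y     , inj₂ refl = 0 , val₂ x (y , refl) (sym (*-identityˡ x))
    ... | zero  , inj₁ refl = contradiction x>0 (<-irrefl refl)
    ... | suc y , inj₁ refl with rec (m<m*n (suc y) 2 (s≤s (s≤s z≤n))) z<s
    ...   | v , val₂ o odd y≡ = suc v , val₂ o odd (trans (cong (_* 2) y≡) (sym (double-assoc (2 ^ v) o)))

  odd-part-unique : ∀ v w {o o′} → Odd o → Odd o′ → 2 ^ v * o ≡ 2 ^ w * o′ → v ≡ w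
  odd-part-unique zero    zero    _         _          _ = refl
  odd-part-unique zero    (suc w) (r , refl) _         e =
    contradiction (trans (sym (*-identityˡ _)) (trans e (double-assoc (2 ^ w) _))) (odd≢even r (2 ^ w * _))
  odd-part-unique (suc v) zero    _         (r , refl) e =
    contradiction (trans (sym (*-identityˡ _)) (trans (sym e) (double-assoc (2 ^ v) _))) (odd≢even r (2 ^ v * _))
  odd-part-unique (suc v) (suc w) {o} {o′} odd odd′ e = cong suc (odd-part-unique v w odd odd′ halved)
    where
    halved : 2 ^ v * o ≡ 2 ^ w * o′
    halved = *-cancelʳ-≡ _ _ 2 (trans (sym (double-assoc (2 ^ v) o)) (trans e (double-assoc (2 ^ w) o′)))

  val₂-unique : ∀ {x v w} → Val₂ x v → Val₂ x w → v ≡ w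
  val₂-unique {v = v} {w} (val₂ _ odd e) (val₂ _ odd′ e′) = odd-part-unique v w odd odd′ (trans (sym e) e′)

  odd-* : ∀ {a b} → Odd a → Odd b → Odd (a * b)
  odd-* (r , refl) (s , refl) = r + s + r * s * 2 , lemma r s
    where
    lemma : ∀ r s → suc (r * 2) * suc (s * 2) ≡ suc ((r + s + r * s * 2) * 2)
    lemma = solve-∀

  val₂-* : ∀ {x y v w} → Val₂ x v → Val₂ y w → Val₂ (x * y) (v + w)
  val₂-* {v = v} {w} (val₂ o odd refl) (val₂ o′ odd′ refl) =
    val₂ (o * o′) (odd-* odd odd′) (trans (interchange (2 ^ v) (2 ^ w) o o′) (cong (_* (o * o′)) (sym (^-distribˡ-+-* 2 v w))))
    where
    interchange : ∀ p q o o′ → p * o * (q * o′) ≡ p * q * (o * o′)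
    interchange = solve-∀

  val₂-positive : ∀ {x v} → Val₂ x v → 0 < x
  val₂-positive {v = v} (val₂ _ (r , refl) refl) = *-mono-≤ (m^n>0 2 v) (s≤s (z≤n {r * 2}))

  ∣-val₂ : ∀ {m x v} → 2 ^ m ∣ x → Val₂ x v → m ≤ v
  ∣-val₂ {zero}          _              _                         = z≤n
  ∣-val₂ {suc m} {v = zero}  (divides u e) (val₂ _ (r , refl) e′) =
    contradiction (trans (sym (*-identityˡ _)) (trans (sym e′) (trans e (shift u (2 ^ m))))) (odd≢even r (u * 2 ^ m))
  ∣-val₂ {suc m} {v = suc v} (divides u e) (val₂ o odd e′) =
    s≤s (∣-val₂ (divides u halved) (val₂ o odd refl))
    where
    halved : 2 ^ v * o ≡ u * 2 ^ m
    halved = *-cancelʳ-≡ _ _ 2 (trans (sym (double-assoc (2 ^ v) o)) (trans (sym e′) (trans e (shift u (2 ^ m)))))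

  val₂-suc : ∀ a q → Val₂ (suc q) a → a + B (suc q) ≡ suc (B q)
  val₂-suc zero q (val₂ o (r , refl) e) = begin
    B (suc q)         ≡⟨ cong B (trans e (*-identityˡ _)) ⟩
    B (suc (r * 2))   ≡⟨ B-double+1 r ⟩
    suc (B r)         ≡⟨ cong suc (sym (B-double r)) ⟩
    suc (B (r * 2))   ≡⟨ cong (suc ∘ B) (suc-injective (trans e (*-identityˡ _))) ⟨
    suc (B q)         ∎
    where open ≡-Reasoning
  val₂-suc (suc a) q (val₂ o odd e) with 2 ^ a * o in eq
  ... | zero  = contradiction (trans e (trans (double-assoc (2 ^ a) o) (cong (_* 2) eq))) λ ()
  ... | suc y = cong suc (begin
    a + B (suc q)       ≡⟨ cong (λ z → a + B z) q+1≡ ⟩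
    a + B (suc y * 2)   ≡⟨ cong (a +_) (B-double (suc y)) ⟩
    a + B (suc y)       ≡⟨ val₂-suc a y (val₂ o odd (sym eq)) ⟩
    suc (B y)           ≡⟨ B-double+1 y ⟨
    B (suc (y * 2))     ≡⟨ cong B (suc-injective q+1≡) ⟨
    B q                 ∎)
    where
    open ≡-Reasoning
    q+1≡ : suc q ≡ suc y * 2
    q+1≡ = trans e (trans (double-assoc (2 ^ a) o) (cong (_* 2) eq))

  B-suc≤ : ∀ m → B (suc m) ≤ suc (B m)
  B-suc≤ m with val₂-exists (suc m) z<s
  ... | a , val = subst (B (suc m) ≤_) (val₂-suc a m val) (m≤n+m (B (suc m)) a)

module CentralBinomial where
  open import Data.Nat.Base using (_+_; _*_)
  open import Data.Nat.Properties
  open import Data.Nat.Combinatorics using (_C_; nCk+nC[k+1]≡[n+1]C[k+1]; nC1≡n; nCk≡nC[n∸k])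
  open import Data.Nat.Tactic.RingSolver using (solve-∀)
  open TwoAdicValuation

  pascal : ∀ n k → suc n C suc k ≡ n C k + n C suc k
  pascal n k = sym (nCk+nC[k+1]≡[n+1]C[k+1] n k)

  absorption : ∀ n k → suc k * (suc n C suc k) ≡ suc n * (n C k)
  absorption zero    zero    = refl
  absorption zero    (suc k) = *-zeroʳ (suc (suc k))
  absorption (suc n) zero    = trans (*-identityˡ _) (trans (nC1≡n (suc (suc n))) (sym (*-identityʳ _)))
  absorption (suc n) (suc k) = begin
    suc (suc k) * (suc (suc n) C suc (suc k))
      ≡⟨ cong (suc (suc k) *_) (pascal (suc n) (suc k)) ⟩
    suc (suc k) * (X + Y)
      ≡⟨ split (suc k) X Y ⟩
    X + suc k * X + suc (suc k) * Y
      ≡⟨ cong₂ (λ a b → X + a + b) (absorption n k) (absorption n (suc k)) ⟩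
    X + suc n * (n C k) + suc n * (n C suc k)
      ≡⟨ join (suc n) X (n C k) (n C suc k) ⟩
    X + suc n * (n C k + n C suc k)
      ≡⟨ cong (λ z → X + suc n * z) (pascal n k) ⟨
    suc (suc n) * X
      ∎
    where
    open ≡-Reasoning
    X = suc n C suc k
    Y = suc n C suc (suc k)
    split : ∀ k X Y → suc k * (X + Y) ≡ X + k * X + suc k * Y
    split = solve-∀
    join : ∀ m X a b → X + m * a + m * b ≡ X + m * (a + b)
    join = solve-∀

  central-binomial-step : ∀ q → suc q * ((suc q + suc q) C suc q) ≡ 2 * suc (q + q) * ((q + q) C q)
  central-binomial-step q = begin
    suc q * ((suc q + suc q) C suc q)   ≡⟨ cong (λ m → suc q * (m C suc q)) (+-suc (suc q) q) ⟩
    suc q * (suc M C suc q)             ≡⟨ cong (suc q *_) (pascal M q) ⟩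
    suc q * (M C q + M C suc q)         ≡⟨ cong (λ z → suc q * (z + M C suc q)) symmetric ⟩
    suc q * (M C suc q + M C suc q)     ≡⟨ double (suc q) (M C suc q) ⟩
    2 * (suc q * (M C suc q))           ≡⟨ cong (2 *_) (absorption (q + q) q) ⟩
    2 * (M * ((q + q) C q))             ≡⟨ *-assoc 2 M _ ⟨
    2 * M * ((q + q) C q)               ∎
    where
    open ≡-Reasoning
    M = suc (q + q)
    symmetric : M C q ≡ M C suc q
    symmetric = trans (nCk≡nC[n∸k] (m≤n⇒m≤1+n (m≤m+n q q)))
                      (cong (M C_) (trans (+-∸-assoc 1 (m≤m+n q q)) (cong suc (m+n∸m≡n q q))))
    double : ∀ a x → a * (x + x) ≡ 2 * (a * x)
    double = solve-∀

  val₂-central-binomial : ∀ q → Val₂ ((q + q) C q) (B q)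
  val₂-central-binomial zero    = val₂ 1 (0 , refl) refl
  val₂-central-binomial (suc q) = subst (Val₂ Z) (+-cancelˡ-≡ a b (B (suc q)) (trans a+b≡ (sym (val₂-suc a q val-q+1)))) val-Z
    where
    Z = (suc q + suc q) C suc q
    val-step : Val₂ (suc q * Z) (1 + B q)
    val-step = subst (λ x → Val₂ x (1 + B q)) (sym (central-binomial-step q))
                 (val₂-* (val₂ (suc (q + q)) (q , cong suc (+-comm-*2 q)) refl) (val₂-central-binomial q))
      where
      +-comm-*2 : ∀ q → q + q ≡ q * 2
      +-comm-*2 = solve-∀
    a = proj₁ (val₂-exists (suc q) z<s)
    val-q+1 = proj₂ (val₂-exists (suc q) z<s)
    Z>0 : 0 < Z
    Z>0 = n≢0⇒n>0 λ Z≡0 → <⇒≢ (val₂-positive val-step) (sym (trans (cong (suc q *_) Z≡0) (*-zeroʳ (suc q))))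
    b = proj₁ (val₂-exists Z Z>0)
    val-Z = proj₂ (val₂-exists Z Z>0)
    a+b≡ : a + b ≡ suc (B q)
    a+b≡ = val₂-unique (val₂-* val-q+1 val-Z) val-step

module MajorityRegime {n k : ℕ} (n<2k : n < 2 ℕ.* k) (k≤n : k ≤ n) where
  open import Data.Nat.Base using (_+_; _*_; _∸_)
  open import Data.Nat.Properties

  q : ℕ
  q = n ∸ k

  q+k≡n : q + k ≡ n
  q+k≡n = m∸n+n≡m k≤n

  q<k : q < k
  q<k = +-cancelʳ-< k q k (subst₂ _<_ (sym q+k≡n) (cong (k +_) (+-identityʳ k)) n<2k)

module Cost where
  open import Data.Nat.Base using (_+_; _*_; _∸_)
  open import Data.Nat.Properties
  open import Data.Nat.Tactic.RingSolver using (solve-∀)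
  open BinaryDigits
  open TwoAdicValuation

  cost : ℕ → ℕ
  cost p = 2 * p ∸ B p

  ⌊2y/2⌋ : ∀ y → ⌊ y * 2 /2⌋ ≡ y
  ⌊2y/2⌋ zero    = refl
  ⌊2y/2⌋ (suc y) = cong suc (⌊2y/2⌋ y)

  ⌊2y+1/2⌋ : ∀ y → ⌊ suc (y * 2) /2⌋ ≡ y
  ⌊2y+1/2⌋ zero    = refl
  ⌊2y+1/2⌋ (suc y) = cong suc (⌊2y+1/2⌋ y)

  private
    B≤2* : ∀ y → B y ≤ 2 * y
    B≤2* y = ≤-trans (B≤ y) (m≤n*m y 2)

  cost-halving : ∀ p → p + cost ⌊ p /2⌋ ≡ cost p
  cost-halving p with even-or-odd p
  ... | y , inj₁ refl = begin
    y * 2 + (2 * ⌊ y * 2 /2⌋ ∸ B ⌊ y * 2 /2⌋) ≡⟨ cong (λ h → y * 2 + (2 * h ∸ B h)) (⌊2y/2⌋ y) ⟩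
    y * 2 + (2 * y ∸ B y)                     ≡⟨ +-∸-assoc (y * 2) (B≤2* y) ⟨
    (y * 2 + 2 * y) ∸ B y                     ≡⟨ cong₂ _∸_ (lemma y) (sym (B-double y)) ⟩
    2 * (y * 2) ∸ B (y * 2)                   ∎
    where
    open ≡-Reasoning
    lemma : ∀ y → y * 2 + 2 * y ≡ 2 * (y * 2)
    lemma = solve-∀
  ... | y , inj₂ refl = begin
    suc (y * 2) + (2 * ⌊ suc (y * 2) /2⌋ ∸ B ⌊ suc (y * 2) /2⌋) ≡⟨ cong (λ h → suc (y * 2) + (2 * h ∸ B h)) (⌊2y+1/2⌋ y) ⟩
    suc (y * 2) + (2 * y ∸ B y)                                 ≡⟨ +-∸-assoc (suc (y * 2)) (B≤2* y) ⟨
    suc (y * 2 + 2 * y) ∸ B y                                   ≡⟨⟩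
    suc (suc (y * 2 + 2 * y)) ∸ suc (B y)                       ≡⟨ cong₂ _∸_ (lemma y) (sym (B-double+1 y)) ⟩
    2 * suc (y * 2) ∸ B (suc (y * 2))                           ∎
    where
    open ≡-Reasoning
    lemma : ∀ y → suc (suc (y * 2 + 2 * y)) ≡ 2 * suc (y * 2)
    lemma = solve-∀

  cost-mono : ∀ {a b} → a ≤ b → cost a ≤ cost b
  cost-mono {a} {zero}  z≤n = ≤-refl
  cost-mono {a} {suc b} a≤ with m≤n⇒m<n∨m≡n a≤
  ... | inj₂ refl     = ≤-refl
  ... | inj₁ (s≤s a≤b) = ≤-trans (cost-mono a≤b) step
    where
    step : cost b ≤ cost (suc b)
    step = begin
      2 * b ∸ B b                   ≤⟨ ∸-monoˡ-≤ (B b) (n≤1+n (2 * b)) ⟩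
      suc (2 * b) ∸ B b             ≤⟨ ∸-monoʳ-≤ (suc (suc (2 * b))) (B-suc≤ b) ⟩
      suc (suc (2 * b)) ∸ B (suc b) ≡⟨ cong (_∸ B (suc b)) (sym (*-suc 2 b)) ⟩
      2 * suc b ∸ B (suc b)         ∎
      where open ≤-Reasoning

module Tallies where
  open import Data.Nat.Base using (_+_)
  open import Data.Nat.Tactic.RingSolver using (solve-∀)

  δ : Bool → Bool → ℕ
  δ x b = if does (x ≟ᵇ b) then 1 else 0

  δ-complement : ∀ x b → δ x b + δ x (not b) ≡ 1
  δ-complement true  true  = refl
  δ-complement true  false = refl
  δ-complement false true  = refl
  δ-complement false false = refl

  δ-not : ∀ x b → δ x b + δ (not x) b ≡ 1
  δ-not true  true  = refl
  δ-not true  false = refl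
  δ-not false true  = refl
  δ-not false false = refl

  count-complement : ∀ {n} (c : Colouring n) b → count c b + count c (not b) ≡ n
  count-complement {zero}  c b = refl
  count-complement {suc n} c b = begin
    δ (c fzero) b + C b + (δ (c fzero) (not b) + C (not b))  ≡⟨ interchange (δ (c fzero) b) (C b) _ (C (not b)) ⟩
    δ (c fzero) b + δ (c fzero) (not b) + (C b + C (not b))  ≡⟨ cong₂ _+_ (δ-complement (c fzero) b) (count-complement (c ∘ fsuc) b) ⟩
    suc n                                                    ∎
    where
    open ≡-Reasoning
    C : Bool → ℕ
    C = count (c ∘ fsuc)
    interchange : ∀ a b c d → a + b + (c + d) ≡ a + c + (b + d)
    interchange = solve-∀

module Tournament {n : ℕ} where
  open import Data.Nat.Base using (_+_; _*_)
  open import Data.Nat.Properties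
  open import Data.Nat.Tactic.RingSolver using (solve-∀)
  open Cost
  open Tallies

  Pairs : Set
  Pairs = List (Fin n × Fin n)

  compareAll : Pairs → List (Fin n) → (List (Fin n) → Strategy n) → Strategy n
  compareAll []             K k = k K
  compareAll ((x , y) ∷ ps) K k = compare x y (compareAll ps (x ∷ K) k) (compareAll ps K k)

  survivors : Colouring n → Pairs → List (Fin n) → List (Fin n)
  survivors c []             K = K
  survivors c ((x , y) ∷ ps) K = survivors c ps (if does (c x ≟ᵇ c y) then x ∷ K else K)

  pairOff : List (Fin n) → Fin n → Pairs × Fin n
  pairOff []          t = [] , t
  pairOff (x ∷ [])    _ = [] , x
  pairOff (x ∷ y ∷ K) t = (x , y) ∷ proj₁ (pairOff K t) , proj₂ (pairOff K t)

  -- The fuel only has to exceed the number of pairs, which at least halves in each round.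
  tournament : ℕ → Pairs → Fin n → Strategy n
  tournament zero    _       t = answer t
  tournament (suc f) []      t = answer t
  tournament (suc f) P@(_ ∷ _) t = compareAll P [] λ K → tournament f (proj₁ (pairOff K t)) (proj₂ (pairOff K t))

  run-compareAll : ∀ c ps K k → run (compareAll ps K k) c ≡ run (k (survivors c ps K)) c
  run-compareAll c []             K k = refl
  run-compareAll c ((x , y) ∷ ps) K k with does (c x ≟ᵇ c y)
  ... | true  = run-compareAll c ps (x ∷ K) k
  ... | false = run-compareAll c ps K k

  length-survivors : ∀ c ps K → length (survivors c ps K) ≤ length ps + length K
  length-survivors c []             K = ≤-refl
  length-survivors c ((x , y) ∷ ps) K with does (c x ≟ᵇ c y)
  ... | true  = subst (length (survivors c ps (x ∷ K)) ≤_) (+-suc (length ps) (length K)) (length-survivors c ps (x ∷ K))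
  ... | false = m≤n⇒m≤1+n (length-survivors c ps K)

  length-pairOff : ∀ K t → length (proj₁ (pairOff K t)) ≡ ⌊ length K /2⌋
  length-pairOff []          t = refl
  length-pairOff (x ∷ [])    t = refl
  length-pairOff (x ∷ y ∷ K) t = cong suc (length-pairOff K t)

  tallyBalls : Colouring n → Bool → List (Fin n) → ℕ
  tallyBalls c b []      = 0
  tallyBalls c b (x ∷ K) = δ (c x) b + tallyBalls c b K

  tallyPairs : Colouring n → Bool → Pairs → ℕ
  tallyPairs c b []            = 0
  tallyPairs c b ((x , y) ∷ P) = δ (c x) b + δ (c y) b + tallyPairs c b P

  tally : Colouring n → Bool → Pairs × Fin n → ℕ
  tally c b (P , t) = tallyPairs c b P + δ (c t) b

  discord : Colouring n → Pairs → ℕ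
  discord c []            = 0
  discord c ((x , y) ∷ P) = (if does (c x ≟ᵇ c y) then 0 else 1) + discord c P

  tallyPairs-survivors : ∀ c b ps K →
    tallyPairs c b ps + 2 * tallyBalls c b K ≡ 2 * tallyBalls c b (survivors c ps K) + discord c ps
  tallyPairs-survivors c b []             K = sym (+-identityʳ _)
  tallyPairs-survivors c b ((x , y) ∷ ps) K with c x ≟ᵇ c y
  ... | yes cx≡cy rewrite sym cx≡cy =
    trans (kept (δ (c x) b) (tallyPairs c b ps) (tallyBalls c b K)) (tallyPairs-survivors c b ps (x ∷ K))
    where
    kept : ∀ d P T → d + d + P + 2 * T ≡ P + 2 * (d + T)
    kept = solve-∀
  ... | no cx≢cy rewrite ¬-not (cx≢cy ∘ sym) | δ-not (c x) b =
    trans (cong suc (tallyPairs-survivors c b ps K)) (sym (+-suc _ _))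

  evenLength : List (Fin n) → Bool
  evenLength []          = true
  evenLength (x ∷ [])    = false
  evenLength (x ∷ y ∷ K) = evenLength K

  tally-pairOff : ∀ c b K t → tally c b (pairOff K t) ≡ tallyBalls c b K + (if evenLength K then δ (c t) b else 0)
  tally-pairOff c b []          t = refl
  tally-pairOff c b (x ∷ [])    t = sym (trans (+-identityʳ _) (+-identityʳ _))
  tally-pairOff c b (x ∷ y ∷ K) t = begin
    δ (c x) b + δ (c y) b + tallyPairs c b P + δ (c t′) b  ≡⟨ reassoc (δ (c x) b) (δ (c y) b) _ _ ⟩
    δ (c x) b + (δ (c y) b + tally c b (P , t′))         ≡⟨ cong (λ z → δ (c x) b + (δ (c y) b + z)) (tally-pairOff c b K t) ⟩
    δ (c x) b + (δ (c y) b + (tallyBalls c b K + e))     ≡⟨ reassoc′ (δ (c x) b) (δ (c y) b) _ e ⟩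
    δ (c x) b + (δ (c y) b + tallyBalls c b K) + e       ∎
    where
    open ≡-Reasoning
    P  = proj₁ (pairOff K t)
    t′ = proj₂ (pairOff K t)
    e  = if evenLength K then δ (c t) b else 0
    reassoc : ∀ a b p d → a + b + p + d ≡ a + (b + (p + d))
    reassoc = solve-∀
    reassoc′ : ∀ a b k e → a + (b + (k + e)) ≡ a + (b + k) + e
    reassoc′ = solve-∀

  Leads : Colouring n → Fin n → (Bool → ℕ) → Set
  Leads c a N = N (not (c a)) < N (c a)

  lead-doubles : ∀ {k₀ k₁ d₀ d₁} D e → d₀ + d₁ ≡ 1 →
    k₀ + (if e then d₀ else 0) < k₁ + (if e then d₁ else 0) → 2 * k₀ + D + d₀ < 2 * k₁ + D + d₁
  lead-doubles {k₀} {k₁} {zero} {suc zero} D e refl lead = begin-strict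
    2 * k₀ + D + 0  ≤⟨ +-monoˡ-≤ 0 (+-monoˡ-≤ D (*-monoʳ-≤ 2 (k₀≤k₁ e lead))) ⟩
    2 * k₁ + D + 0  <⟨ +-monoʳ-< (2 * k₁ + D) z<s ⟩
    2 * k₁ + D + 1  ∎
    where
    open ≤-Reasoning
    k₀≤k₁ : ∀ e → k₀ + (if e then 0 else 0) < k₁ + (if e then 1 else 0) → k₀ ≤ k₁
    k₀≤k₁ true  lead = ≤-pred (subst₂ _<_ (+-identityʳ k₀) (+-comm k₁ 1) lead)
    k₀≤k₁ false lead = <⇒≤ (subst₂ _<_ (+-identityʳ k₀) (+-identityʳ k₁) lead)
  lead-doubles {k₀} {k₁} {suc zero} {zero} D e refl lead = begin-strict
    2 * k₀ + D + 1  ≡⟨ shift k₀ D ⟩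
    2 * k₀ + 1 + D  <⟨ +-monoˡ-< D (2k₀+1<2k₁ (k₀<k₁ e lead)) ⟩
    2 * k₁ + D      ≡⟨ +-identityʳ _ ⟨
    2 * k₁ + D + 0  ∎
    where
    open ≤-Reasoning
    shift : ∀ k D → 2 * k + D + 1 ≡ 2 * k + 1 + D
    shift = solve-∀
    k₀<k₁ : ∀ e → k₀ + (if e then 1 else 0) < k₁ + (if e then 0 else 0) → k₀ < k₁
    k₀<k₁ true  lead = <-trans (n<1+n k₀) (subst₂ _<_ (+-comm k₀ 1) (+-identityʳ k₁) lead)
    k₀<k₁ false lead = subst₂ _<_ (+-identityʳ k₀) (+-identityʳ k₁) lead
    2k₀+1<2k₁ : k₀ < k₁ → 2 * k₀ + 1 < 2 * k₁
    2k₀+1<2k₁ k₀<k₁ = subst (_≤ 2 * k₁) (sym (shift′ k₀)) (*-monoʳ-≤ 2 k₀<k₁)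
      where
      shift′ : ∀ k → suc (2 * k + 1) ≡ 2 * suc k
      shift′ = solve-∀

  lead-answer : ∀ c t → Leads c t (λ b → tally c b ([] , t))
  lead-answer c t with c t
  ... | true  = z<s
  ... | false = z<s

  tournament-leads : ∀ f c P t → length P ≤ f → Leads c (run (tournament f P t) c) (λ b → tally c b (P , t))
  tournament-leads zero    c []        t _ = lead-answer c t
  tournament-leads (suc f) c []        t _ = lead-answer c t
  tournament-leads (suc f) c P@(_ ∷ _) t |P|≤ =
    subst (λ a → Leads c a (λ b → tally c b (P , t))) (sym (run-compareAll c P [] κ)) $
    subst₂ _<_ (balance (not (c a))) (balance (c a))
      (lead-doubles (discord c P) (evenLength K) (trans (+-comm (δ (c t) (not (c a))) _) (δ-complement (c t) (c a)))
        (subst₂ _<_ (tally-pairOff c (not (c a)) K t) (tally-pairOff c (c a) K t)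
          (tournament-leads f c P′ t′ |P′|≤f)))
    where
    κ : List (Fin n) → Strategy n
    κ K = tournament f (proj₁ (pairOff K t)) (proj₂ (pairOff K t))
    K  = survivors c P []
    P′ = proj₁ (pairOff K t)
    t′ = proj₂ (pairOff K t)
    a  = run (tournament f P′ t′) c
    balance : ∀ b → 2 * tallyBalls c b K + discord c P + δ (c t) b ≡ tally c b (P , t)
    balance b = cong (_+ δ (c t) b) (trans (sym (tallyPairs-survivors c b P [])) (+-identityʳ _))
    |P′|≤f : length P′ ≤ f
    |P′|≤f = begin
      length P′                   ≡⟨ length-pairOff K t ⟩
      ⌊ length K /2⌋              ≤⟨ ⌊n/2⌋-mono (subst (length K ≤_) (+-identityʳ _) (length-survivors c P [])) ⟩
      ⌊ length P /2⌋              ≤⟨ ⌊n/2⌋-mono |P|≤ ⟩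
      ⌊ suc f /2⌋                 ≤⟨ ≤-pred (⌊n/2⌋<n f) ⟩
      f                           ∎
      where open ≤-Reasoning

  depth-compareAll : ∀ ps K k M → (∀ K′ → length K′ ≤ length ps + length K → depth (k K′) ≤ M) →
    depth (compareAll ps K k) ≤ length ps + M
  depth-compareAll []             K k M bound = bound K ≤-refl
  depth-compareAll ((x , y) ∷ ps) K k M bound = s≤s (⊔-lub
    (depth-compareAll ps (x ∷ K) k M λ K′ ≤ → bound K′ (subst (length K′ ≤_) (+-suc (length ps) (length K)) ≤))
    (depth-compareAll ps K k M λ K′ ≤ → bound K′ (m≤n⇒m≤1+n ≤)))

  tournament-depth : ∀ f P t → depth (tournament f P t) ≤ cost (length P)
  tournament-depth zero    P         t = z≤n
  tournament-depth (suc f) []        t = z≤n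
  tournament-depth (suc f) P@(_ ∷ _) t =
    subst (depth (compareAll P [] κ) ≤_) (cost-halving (length P)) (depth-compareAll P [] κ (cost ⌊ length P /2⌋) round)
    where
    κ : List (Fin n) → Strategy n
    κ K = tournament f (proj₁ (pairOff K t)) (proj₂ (pairOff K t))
    round : ∀ K → length K ≤ length P + 0 → depth (κ K) ≤ cost ⌊ length P /2⌋
    round K |K|≤ = ≤-trans (tournament-depth f _ _)
      (subst (λ m → cost m ≤ _) (sym (length-pairOff K t)) (cost-mono (⌊n/2⌋-mono (subst (length K ≤_) (+-identityʳ _) |K|≤))))

module UpperBound where
  open import Data.Nat.Base using (_+_; _*_; _∸_; _⊓_)
  open import Data.Nat.Properties
  open import Data.Fin.Base using (fromℕ<)
  open import Data.List.Base using (allFin)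
  open import Data.List.Properties using (length-take; length-tabulate)
  open import Data.Nat.Tactic.RingSolver using (solve-∀)
  open import Data.Bool.Properties using (not-involutive)
  open Cost
  open Tallies

  private
    twice : ∀ q → q + q ≡ q * 2
    twice = solve-∀

  module _ {n : ℕ} (c : Colouring n) where
    open Tournament {n}

    tallyBalls-tabulate : ∀ {m} b (g : Fin m → Fin n) → tallyBalls c b (tabulate g) ≡ count (c ∘ g) b
    tallyBalls-tabulate {zero}  b g = refl
    tallyBalls-tabulate {suc m} b g = cong (δ (c (g fzero)) b +_) (tallyBalls-tabulate b (g ∘ fsuc))

    tallyBalls-take : ∀ b m L → tallyBalls c b (take m L) ≤ tallyBalls c b L
    tallyBalls-take b zero    L       = z≤n
    tallyBalls-take b (suc m) []      = z≤n
    tallyBalls-take b (suc m) (x ∷ L) = +-monoʳ-≤ (δ (c x) b) (tallyBalls-take b m L)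

    tallyBalls-complement : ∀ b L → tallyBalls c b L + tallyBalls c (not b) L ≡ length L
    tallyBalls-complement b []      = refl
    tallyBalls-complement b (x ∷ L) = begin
      δ (c x) b + T b + (δ (c x) (not b) + T (not b)) ≡⟨ interchange (δ (c x) b) (T b) _ _ ⟩
      δ (c x) b + δ (c x) (not b) + (T b + T (not b)) ≡⟨ cong₂ _+_ (δ-complement (c x) b) (tallyBalls-complement b L) ⟩
      suc (length L)                                  ∎
      where
      open ≡-Reasoning
      T : Bool → ℕ
      T b = tallyBalls c b L
      interchange : ∀ a b c d → a + b + (c + d) ≡ a + c + (b + d)
      interchange = solve-∀

    evenLength-odd : ∀ y L → length L ≡ suc (y * 2) → evenLength L ≡ false
    evenLength-odd zero    (x ∷ [])     _ = refl
    evenLength-odd (suc y) (x ∷ x′ ∷ L) e = evenLength-odd y L (suc-injective (suc-injective e))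

  minority<majority : ∀ {x y q} → x + y ≡ suc (q * 2) → y ≤ q → y < x
  minority<majority {x} {y} {q} x+y≡ y≤q with y <? x
  ... | yes y<x = y<x
  ... | no  y≮x = contradiction (begin
    suc (q * 2) ≡⟨ x+y≡ ⟨
    x + y       ≤⟨ +-mono-≤ (≤-trans (≮⇒≥ y≮x) y≤q) y≤q ⟩
    q + q       ≡⟨ twice q ⟩
    q * 2       ∎) (<-irrefl refl)
    where open ≤-Reasoning

  module _ {n k : ℕ} (n<2k : n < 2 * k) (k≤n : k ≤ n) where
    open MajorityRegime n<2k k≤n
    open Tournament {n}

    sampleSize : ℕ
    sampleSize = suc (q * 2)

    sample : List (Fin n)
    sample = take sampleSize (allFin n)

    length-sample : length sample ≡ sampleSize
    length-sample = trans (length-take sampleSize (allFin n)) (trans (cong (sampleSize ⊓_) (length-tabulate id)) (m≤n⇒m⊓n≡m sampleSize≤n))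
      where
      sampleSize≤n : sampleSize ≤ n
      sampleSize≤n = subst (sampleSize ≤_) q+k≡n (subst (_≤ q + k) (trans (+-suc q q) (cong suc (twice q))) (+-monoʳ-≤ q q<k))

    -- Any ball will do: the sample has odd length, so pairOff never uses it.
    someBall : Fin n
    someBall = fromℕ< (<-≤-trans (≤-<-trans z≤n q<k) k≤n)

    pairs : Pairs
    pairs = proj₁ (pairOff sample someBall)

    tieBreak : Fin n
    tieBreak = proj₂ (pairOff sample someBall)

    strategy : Strategy n
    strategy = tournament q pairs tieBreak

    length-pairs : length pairs ≡ q
    length-pairs = trans (length-pairOff sample someBall) (trans (cong ⌊_/2⌋ length-sample) (⌊2y+1/2⌋ q))

    strategy-depth : depth strategy ≤ cost q
    strategy-depth = subst (λ p → depth strategy ≤ cost p) length-pairs (tournament-depth q pairs tieBreak)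

    sample-majority : ∀ c b → k ≤ count c b → tallyBalls c (not b) sample < tallyBalls c b sample
    sample-majority c b k≤ = minority<majority (trans (tallyBalls-complement c b sample) length-sample)
      (≤-trans (subst (tallyBalls c (not b) sample ≤_) (tallyBalls-tabulate c (not b) id) (tallyBalls-take c (not b) sampleSize (allFin n))) count¬b≤q)
      where
      count¬b≤q : count c (not b) ≤ q
      count¬b≤q = +-cancelʳ-≤ k _ q (begin
        count c (not b) + k                ≤⟨ +-monoʳ-≤ (count c (not b)) k≤ ⟩
        count c (not b) + count c b        ≡⟨ +-comm (count c (not b)) _ ⟩
        count c b + count c (not b)        ≡⟨ count-complement c b ⟩
        n                                  ≡⟨ q+k≡n ⟨
        q + k                              ∎)
        where open ≤-Reasoning

    strategy-leads : ∀ c → Leads c (run strategy c) (λ b → tallyBalls c b sample)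
    strategy-leads c = subst₂ _<_ (tally≡ _) (tally≡ _) (tournament-leads q c pairs tieBreak (≤-reflexive length-pairs))
      where
      tally≡ : ∀ b → tally c b (pairs , tieBreak) ≡ tallyBalls c b sample
      tally≡ b = trans (tally-pairOff c b sample someBall)
        (trans (cong (λ e → tallyBalls c b sample + (if e then δ (c someBall) b else 0)) (evenLength-odd c q sample length-sample))
               (+-identityʳ _))

    announces-majority : ∀ c b → k ≤ count c b → c (run strategy c) ≡ b
    announces-majority c b k≤ with c (run strategy c) ≟ᵇ b
    ... | yes announced≡b = announced≡b
    ... | no  announced≢b = contradiction (sample-majority c b k≤) (<-asym
      (subst (λ x → N x < N (not b)) (not-involutive b) (subst (λ x → N (not x) < N x) (¬-not announced≢b) (strategy-leads c))))
      where
      N : Bool → ℕ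
      N b′ = tallyBalls c b′ sample

    strategy-wins : Wins k strategy
    strategy-wins c (inj₁ k≤) = subst (λ b → k ≤ count c b) (sym (announces-majority c true k≤)) k≤
    strategy-wins c (inj₂ k≤) = subst (λ b → k ≤ count c b) (sym (announces-majority c false k≤)) k≤

  upper-bound : ∀ n k → n < 2 * k → k ≤ n → Σ (Strategy n) λ s → Wins k s × depth s ≤ cost (n ∸ k)
  upper-bound n k n<2k k≤n = strategy n<2k k≤n , strategy-wins n<2k k≤n , strategy-depth n<2k k≤n

module LowerBound where
  import Data.Nat.Properties as ℕ
  open import Data.Vec.Base using (Vec; []; _∷_; lookup; _[_]≔_; _[_]%=_)
  open import Data.Integer.Base using (ℤ; +_; -[1+_]; 0ℤ; 1ℤ; -1ℤ; _+_; _*_; -_; _-_; _^_; _⊖_) renaming (suc to sucℤ)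
  import Data.Integer.Properties as ℤ
  open import Data.Integer.Divisibility.Signed
    using (_∣_; divides; ∣-trans; ∣m∣n⇒∣m+n; ∣m+n∣n⇒∣m; ∣n⇒∣m*n; *-monoʳ-∣; *-cancelˡ-∣; ∣⇒∣ᵤ)
  open import Data.Integer.Tactic.RingSolver using (solve-∀)
  open import Relation.Nullary.Decidable using (dec-true; dec-false)

  2^_ : ℕ → ℤ
  2^ m = + (2 ℕ.^ m)

  2^-∣-≤ : ∀ {m′ m x} → m′ ≤ m → 2^ m ∣ x → 2^ m′ ∣ x
  2^-∣-≤ {m′} {m} m′≤m = ∣-trans (divides (2^ (m ℕ.∸ m′)) power-split)
    where
    power-split : 2^ m ≡ 2^ (m ℕ.∸ m′) * 2^ m′
    power-split = begin
      + (2 ℕ.^ m)                         ≡⟨ cong (λ e → + (2 ℕ.^ e)) (ℕ.m∸n+n≡m m′≤m) ⟨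
      + (2 ℕ.^ (m ℕ.∸ m′ ℕ.+ m′))         ≡⟨ cong +_ (ℕ.^-distribˡ-+-* 2 (m ℕ.∸ m′) m′) ⟩
      + (2 ℕ.^ (m ℕ.∸ m′) ℕ.* 2 ℕ.^ m′)   ≡⟨ ℤ.pos-* (2 ℕ.^ (m ℕ.∸ m′)) (2 ℕ.^ m′) ⟩
      2^ (m ℕ.∸ m′) * 2^ m′               ∎
      where open ≡-Reasoning

  private
    2*x≡x+x : ∀ x → + 2 * x ≡ x + x
    2*x≡x+x = solve-∀

  2^-∣-double : ∀ m {x} → 2^ m ∣ x → 2^ suc m ∣ x + x
  2^-∣-double m {x} = subst₂ _∣_ (sym (ℤ.pos-* 2 (2 ℕ.^ m))) (2*x≡x+x x) ∘ *-monoʳ-∣ (+ 2)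

  2^-∣-halve : ∀ m {x} → 2^ suc m ∣ x + x → 2^ m ∣ x
  2^-∣-halve m {x} = *-cancelˡ-∣ (+ 2) ∘ subst₂ _∣_ (ℤ.pos-* 2 (2 ℕ.^ m)) (sym (2*x≡x+x x))

  2^0∣ : ∀ x → 2^ 0 ∣ x
  2^0∣ x = divides x (sym (ℤ.*-identityʳ x))

  2^-∣-halve-pred : ∀ m {x} → 2^ m ∣ x + x → 2^ (m ℕ.∸ 1) ∣ x
  2^-∣-halve-pred zero    {x} _ = 2^0∣ x
  2^-∣-halve-pred (suc m)     = 2^-∣-halve m

  -1^-square : ∀ e → -1ℤ ^ e * -1ℤ ^ e ≡ 1ℤ
  -1^-square zero    = refl
  -1^-square (suc e) = trans (square (-1ℤ ^ e)) (-1^-square e)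
    where
    square : ∀ a → -1ℤ * a * (-1ℤ * a) ≡ a * a
    square = solve-∀

  module GeneralisedBinomial where
    open import Data.Nat.Combinatorics using (_C_; nCn≡1; nCk+nC[k+1]≡[n+1]C[k+1])

    binomial : ℤ → ℕ → ℤ
    binomial (+ m)     t = + (m C t)
    binomial -[1+ m ] t = -1ℤ ^ t * + ((m ℕ.+ t) C t)

    binomial-zero : ∀ y → binomial y 0 ≡ 1ℤ
    binomial-zero (+ m)     = refl
    binomial-zero -[1+ m ] = refl

    binomial-pascal : ∀ y t → binomial (sucℤ y) (suc t) ≡ binomial y (suc t) + binomial y t
    binomial-pascal (+ m) t = cong +_ (trans (sym (nCk+nC[k+1]≡[n+1]C[k+1] m t)) (ℕ.+-comm (m C t) (m C suc t)))
    binomial-pascal -[1+ zero ] t = begin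
      0ℤ
        ≡⟨ cancel (-1ℤ ^ t) ⟩
      -1ℤ ^ suc t * 1ℤ + -1ℤ ^ t * 1ℤ
        ≡⟨ cong₂ (λ u v → -1ℤ ^ suc t * + u + -1ℤ ^ t * + v) (nCn≡1 (suc t)) (nCn≡1 t) ⟨
      -1ℤ ^ suc t * + (suc t C suc t) + -1ℤ ^ t * + (t C t)
        ∎
      where
      open ≡-Reasoning
      cancel : ∀ a → 0ℤ ≡ -1ℤ * a * 1ℤ + a * 1ℤ
      cancel = solve-∀
    binomial-pascal -[1+ suc m ] t = begin
      -1ℤ ^ suc t * + Y                                ≡⟨ telescope (-1ℤ ^ t) (+ X) (+ Y) ⟩
      -1ℤ ^ suc t * + (X ℕ.+ Y) + -1ℤ ^ t * + X        ≡⟨ cong₂ (λ u v → -1ℤ ^ suc t * + u + -1ℤ ^ t * + (v C t))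
                                                               (nCk+nC[k+1]≡[n+1]C[k+1] (m ℕ.+ suc t) t) (ℕ.+-suc m t) ⟩
      -1ℤ ^ suc t * + ((suc m ℕ.+ suc t) C suc t) + -1ℤ ^ t * + ((suc m ℕ.+ t) C t) ∎
      where
      open ≡-Reasoning
      X = (m ℕ.+ suc t) C t
      Y = (m ℕ.+ suc t) C suc t
      telescope : ∀ a x y → -1ℤ * a * y ≡ -1ℤ * a * (x + y) + a * x
      telescope = solve-∀

  module AlternatingPolynomials where
    open import Data.Nat.Combinatorics using (_C_; k>n⇒nCk≡0)
    open GeneralisedBinomial

    shiftSum : (ℕ → ℤ) → ℕ → ℤ
    shiftSum f z = f z + f (suc z)

    -- (1 + E)^(t+1) f = 0 for the shift E, i.e. f z = (−1)^z p(z) with p a polynomial of degree ≤ t.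
    AltPoly≤ : ℕ → (ℕ → ℤ) → Set
    AltPoly≤ zero    f = ∀ z → shiftSum f z ≡ 0ℤ
    AltPoly≤ (suc t) f = AltPoly≤ t (shiftSum f)

    AltPoly≤-cong : ∀ t {f g} → (∀ z → f z ≡ g z) → AltPoly≤ t f → AltPoly≤ t g
    AltPoly≤-cong zero    f≗g p z = trans (sym (cong₂ _+_ (f≗g z) (f≗g (suc z)))) (p z)
    AltPoly≤-cong (suc t) f≗g p   = AltPoly≤-cong t (λ z → cong₂ _+_ (f≗g z) (f≗g (suc z))) p

    AltPoly≤-neg : ∀ t {f} → AltPoly≤ t f → AltPoly≤ t (λ z → - f z)
    AltPoly≤-neg zero    {f} p z = trans (sym (ℤ.neg-distrib-+ (f z) (f (suc z)))) (cong -_ (p z))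
    AltPoly≤-neg (suc t) {f} p   = AltPoly≤-cong t (λ z → ℤ.neg-distrib-+ (f z) (f (suc z))) (AltPoly≤-neg t p)

    weight : ℕ → ℕ → ℕ → ℤ
    weight q t r = -1ℤ ^ r * binomial (r ⊖ suc q) t

    weight-vanishes : ∀ q t {r} → q < r → r < suc q ℕ.+ t → weight q t r ≡ 0ℤ
    weight-vanishes q t {r} q<r r<k = begin
      -1ℤ ^ r * binomial (r ⊖ suc q) t          ≡⟨ cong (λ y → -1ℤ ^ r * binomial y t) (ℤ.⊖-≥ q<r) ⟩
      -1ℤ ^ r * + ((r ℕ.∸ suc q) C t)           ≡⟨ cong (λ c → -1ℤ ^ r * + c) (k>n⇒nCk≡0 (ℕ.+-cancelˡ-< (suc q) _ t r-q-1<t)) ⟩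
      -1ℤ ^ r * 0ℤ                              ≡⟨ ℤ.*-zeroʳ (-1ℤ ^ r) ⟩
      0ℤ                                        ∎
      where
      open ≡-Reasoning
      r-q-1<t : suc q ℕ.+ (r ℕ.∸ suc q) < suc q ℕ.+ t
      r-q-1<t = subst (_< suc q ℕ.+ t) (sym (ℕ.m+[n∸m]≡n q<r)) r<k

    shiftSum-weight : ∀ q t z → shiftSum (weight q (suc t)) z ≡ - weight q t z
    shiftSum-weight q t z = begin
      a * binomial y (suc t) + -1ℤ * a * binomial (suc z ⊖ suc q) (suc t)
        ≡⟨ cong (λ u → a * binomial y (suc t) + -1ℤ * a * binomial u (suc t)) (ℤ.distribʳ-⊖-+-pos 1 z (suc q)) ⟨
      a * binomial y (suc t) + -1ℤ * a * binomial (sucℤ y) (suc t)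
        ≡⟨ cong (λ u → a * binomial y (suc t) + -1ℤ * a * u) (binomial-pascal y t) ⟩
      a * binomial y (suc t) + -1ℤ * a * (binomial y (suc t) + binomial y t)
        ≡⟨ cancel a (binomial y (suc t)) (binomial y t) ⟩
      - (a * binomial y t)
        ∎
      where
      open ≡-Reasoning
      a = -1ℤ ^ z
      y = z ⊖ suc q
      cancel : ∀ a x y → a * x + -1ℤ * a * (x + y) ≡ - (a * y)
      cancel = solve-∀

    weight-AltPoly≤ : ∀ q t → AltPoly≤ t (weight q t)
    weight-AltPoly≤ q zero z = begin
      -1ℤ ^ z * binomial (z ⊖ suc q) 0 + -1ℤ * -1ℤ ^ z * binomial (suc z ⊖ suc q) 0
        ≡⟨ cong₂ (λ u v → -1ℤ ^ z * u + -1ℤ * -1ℤ ^ z * v) (binomial-zero (z ⊖ suc q)) (binomial-zero (suc z ⊖ suc q)) ⟩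
      -1ℤ ^ z * 1ℤ + -1ℤ * -1ℤ ^ z * 1ℤ
        ≡⟨ cancel (-1ℤ ^ z) ⟩
      0ℤ
        ∎
      where
      open ≡-Reasoning
      cancel : ∀ a → a * 1ℤ + -1ℤ * a * 1ℤ ≡ 0ℤ
      cancel = solve-∀
    weight-AltPoly≤ q (suc t) = AltPoly≤-cong t (λ z → sym (shiftSum-weight q t z)) (AltPoly≤-neg t (weight-AltPoly≤ q t))

  module BooleanCube where
    open import Data.Vec.Properties using ([]≔-lookup; updateAt-cong-local)

    sumCube : ∀ n → (Vec Bool n → ℤ) → ℤ
    sumCube zero    F = F []
    sumCube (suc n) F = sumCube n (F ∘ (false ∷_)) + sumCube n (F ∘ (true ∷_))

    sumCube-cong : ∀ n {F G} → (∀ σ → F σ ≡ G σ) → sumCube n F ≡ sumCube n G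
    sumCube-cong zero    F≗G = F≗G []
    sumCube-cong (suc n) F≗G = cong₂ _+_ (sumCube-cong n (F≗G ∘ (false ∷_))) (sumCube-cong n (F≗G ∘ (true ∷_)))

    sumCube-+ : ∀ n F G → sumCube n (λ σ → F σ + G σ) ≡ sumCube n F + sumCube n G
    sumCube-+ zero    F G = refl
    sumCube-+ (suc n) F G = begin
      sumCube n (λ σ → F (false ∷ σ) + G (false ∷ σ)) + sumCube n (λ σ → F (true ∷ σ) + G (true ∷ σ))
        ≡⟨ cong₂ _+_ (sumCube-+ n (F ∘ (false ∷_)) (G ∘ (false ∷_))) (sumCube-+ n (F ∘ (true ∷_)) (G ∘ (true ∷_))) ⟩
      sumCube n (F ∘ (false ∷_)) + sumCube n (G ∘ (false ∷_)) + (sumCube n (F ∘ (true ∷_)) + sumCube n (G ∘ (true ∷_)))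
        ≡⟨ interchange (sumCube n (F ∘ (false ∷_))) (sumCube n (G ∘ (false ∷_))) (sumCube n (F ∘ (true ∷_))) _ ⟩
      sumCube n (F ∘ (false ∷_)) + sumCube n (F ∘ (true ∷_)) + (sumCube n (G ∘ (false ∷_)) + sumCube n (G ∘ (true ∷_)))
        ∎
      where
      open ≡-Reasoning
      interchange : ∀ a b c d → a + b + (c + d) ≡ a + c + (b + d)
      interchange = solve-∀

    sumCube-zero : ∀ n → sumCube n (λ _ → 0ℤ) ≡ 0ℤ
    sumCube-zero zero    = refl
    sumCube-zero (suc n) = cong₂ _+_ (sumCube-zero n) (sumCube-zero n)

    sumCube-flip : ∀ n j F → sumCube n F ≡ sumCube n (F ∘ (_[ j ]%= not))
    sumCube-flip (suc n) fzero    F = ℤ.+-comm (sumCube n (F ∘ (false ∷_))) _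
    sumCube-flip (suc n) (fsuc j) F = cong₂ _+_ (sumCube-flip n j (F ∘ (false ∷_))) (sumCube-flip n j (F ∘ (true ∷_)))

    sumCube-double : ∀ n j F → sumCube n F + sumCube n F ≡ sumCube n (λ σ → F σ + F (σ [ j ]%= not))
    sumCube-double n j F = trans (cong (λ z → sumCube n F + z) (sumCube-flip n j F)) (sym (sumCube-+ n F (F ∘ (_[ j ]%= not))))

    ∣-sumCube-+ : ∀ {d} n F G → d ∣ sumCube n F → d ∣ sumCube n G → d ∣ sumCube n (λ σ → F σ + G σ)
    ∣-sumCube-+ n F G d∣ΣF d∣ΣG = subst (_ ∣_) (sym (sumCube-+ n F G)) (∣m∣n⇒∣m+n d∣ΣF d∣ΣG)

    flip-pair : ∀ {n} j b (σ : Vec Bool n) (F : Vec Bool n → ℤ) →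
      F σ + F (σ [ j ]%= not) ≡ F (σ [ j ]≔ b) + F (σ [ j ]≔ not b)
    flip-pair j b σ F = begin
      F σ + F (σ [ j ]%= not)                                  ≡⟨ cong₂ (λ τ τ′ → F τ + F τ′) (sym ([]≔-lookup σ j)) (updateAt-cong-local j σ refl) ⟩
      F (σ [ j ]≔ lookup σ j) + F (σ [ j ]≔ not (lookup σ j))  ≡⟨ either-order (lookup σ j) b ⟩
      F (σ [ j ]≔ b) + F (σ [ j ]≔ not b)                      ∎
      where
      open ≡-Reasoning
      either-order : ∀ x b → F (σ [ j ]≔ x) + F (σ [ j ]≔ not x) ≡ F (σ [ j ]≔ b) + F (σ [ j ]≔ not b)
      either-order true  true  = refl
      either-order true  false = ℤ.+-comm (F (σ [ j ]≔ true)) _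
      either-order false true  = ℤ.+-comm (F (σ [ j ]≔ false)) _
      either-order false false = refl

  module CubeDivisibility where
    open AlternatingPolynomials
    open BooleanCube
    open import Data.Nat.Tactic.RingSolver using () renaming (solve-∀ to solve-∀ℕ)

    linearForm : ∀ {k} → (Fin k → Bool → ℕ) → Vec Bool k → ℕ
    linearForm w []      = 0
    linearForm w (x ∷ σ) = w fzero x ℕ.+ linearForm (w ∘ fsuc) σ

    private
      suc∸≤ : ∀ k t → suc k ℕ.∸ t ≤ suc (k ℕ.∸ t)
      suc∸≤ k t = ℕ.m≤n+o⇒m∸n≤o (suc k) t (subst (suc k ≤_) (sym (ℕ.+-suc t _)) (s≤s (ℕ.m≤n+m∸n k t)))

      ∣0 : ∀ {d} → d ∣ 0ℤ
      ∣0 {d} = divides 0ℤ (sym (ℤ.*-zeroˡ d))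

    module _ {k} (L : Vec Bool k → ℕ)
             (IH : ∀ t f → AltPoly≤ t f → ∀ m → 2^ (k ℕ.∸ t) ∣ sumCube k (λ σ → f (L σ ℕ.+ m))) where

      private
        doubled : ∀ t f → AltPoly≤ t f → ∀ m → 2^ (suc k ℕ.∸ t) ∣ sumCube k (λ σ → f (L σ ℕ.+ m) + f (L σ ℕ.+ m))
        doubled t f p m = 2^-∣-≤ (suc∸≤ k t) (subst (_ ∣_) (sym (sumCube-+ k F F)) (2^-∣-double (k ℕ.∸ t) (IH t f p m)))
          where
          F : Vec Bool k → ℤ
          F σ = f (L σ ℕ.+ m)

        shifted : ∀ t f → AltPoly≤ t f → ∀ m → 2^ (suc k ℕ.∸ t) ∣ sumCube k (λ σ → shiftSum f (L σ ℕ.+ m))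
        shifted zero    f p m = subst (_ ∣_) (sym (trans (sumCube-cong k (p ∘ (ℕ._+ m) ∘ L)) (sumCube-zero k))) ∣0
        shifted (suc t) f p m = IH t (shiftSum f) p m

      -- By induction on d, using f x + f (x + d + 1) = shiftSum f (x + d) − (f x + f (x + d)) + 2 f x,
      -- where shiftSum lowers the degree t.
      pair-divisible : ∀ t f → AltPoly≤ t f → ∀ m d →
        2^ (suc k ℕ.∸ t) ∣ sumCube k (λ σ → f (L σ ℕ.+ m) + f (L σ ℕ.+ m ℕ.+ d))
      pair-divisible t f p m zero =
        subst (_ ∣_) (sumCube-cong k λ σ → cong (λ x → f (L σ ℕ.+ m) + f x) (sym (ℕ.+-identityʳ _))) (doubled t f p m)
      pair-divisible t f p m (suc d) = ∣m+n∣n⇒∣m shifted+doubled (pair-divisible t f p m d)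
        where
        P : ℕ → Vec Bool k → ℤ
        P e σ = f (L σ ℕ.+ m) + f (L σ ℕ.+ m ℕ.+ e)
        regroup : ∀ σ → shiftSum f (L σ ℕ.+ (m ℕ.+ d)) + (f (L σ ℕ.+ m) + f (L σ ℕ.+ m)) ≡ P (suc d) σ + P d σ
        regroup σ = begin
          f y + f (suc y) + (f x + f x)               ≡⟨ rearrange (f x) (f y) (f (suc y)) ⟩
          f x + f (suc y) + (f x + f y)               ≡⟨ cong₂ (λ u v → f x + f u + (f x + f v)) x+1+d≡ x+d≡ ⟨
          f x + f (x ℕ.+ suc d) + (f x + f (x ℕ.+ d)) ∎
          where
          open ≡-Reasoning
          x = L σ ℕ.+ m
          y = L σ ℕ.+ (m ℕ.+ d)
          x+d≡ : x ℕ.+ d ≡ y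
          x+d≡ = ℕ.+-assoc (L σ) m d
          x+1+d≡ : x ℕ.+ suc d ≡ suc y
          x+1+d≡ = trans (ℕ.+-suc x d) (cong suc x+d≡)
          rearrange : ∀ a b c → b + c + (a + a) ≡ a + c + (a + b)
          rearrange = solve-∀
        shifted+doubled : 2^ (suc k ℕ.∸ t) ∣ sumCube k (P (suc d)) + sumCube k (P d)
        shifted+doubled = subst (_ ∣_) (trans (sumCube-cong k regroup) (sumCube-+ k (P (suc d)) (P d)))
          (∣-sumCube-+ k _ _ (shifted t f p (m ℕ.+ d)) (doubled t f p m))

    sumCube-AltPoly-divisible : ∀ k (w : Fin k → Bool → ℕ) t f → AltPoly≤ t f → ∀ m →
      2^ (k ℕ.∸ t) ∣ sumCube k (λ σ → f (linearForm w σ ℕ.+ m))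
    sumCube-AltPoly-divisible zero w t f p m =
      subst (λ e → 2^ e ∣ f m) (sym (ℕ.0∸n≡0 t)) (2^0∣ (f m))
    sumCube-AltPoly-divisible (suc k) w t f p m =
      subst (_ ∣_) (sumCube-+ k (F (w fzero false)) (F (w fzero true))) $
      [ pairs _ _
      , (λ t≤f → subst (_ ∣_) (sumCube-cong k λ σ → ℤ.+-comm (F (w fzero true) σ) _) (pairs _ _ t≤f))
      ]′ (ℕ.≤-total (w fzero false) (w fzero true))
      where
      L′ = linearForm (w ∘ fsuc)
      F : ℕ → Vec Bool k → ℤ
      F a σ = f (a ℕ.+ L′ σ ℕ.+ m)
      pairs : ∀ lo hi → lo ≤ hi → 2^ (suc k ℕ.∸ t) ∣ sumCube k (λ σ → F lo σ + F hi σ)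
      pairs lo hi lo≤hi = subst (_ ∣_) (sumCube-cong k λ σ → cong₂ (λ u v → f u + f v) (low σ) (high σ))
        (pair-divisible L′ (sumCube-AltPoly-divisible k (w ∘ fsuc)) t f p (lo ℕ.+ m) (hi ℕ.∸ lo))
        where
        swap : ∀ l a m → l ℕ.+ (a ℕ.+ m) ≡ a ℕ.+ l ℕ.+ m
        swap = solve-∀ℕ
        shuffle : ∀ l a m d → l ℕ.+ (a ℕ.+ m) ℕ.+ d ≡ a ℕ.+ d ℕ.+ l ℕ.+ m
        shuffle = solve-∀ℕ
        low : ∀ σ → L′ σ ℕ.+ (lo ℕ.+ m) ≡ lo ℕ.+ L′ σ ℕ.+ m
        low σ = swap (L′ σ) lo m
        high : ∀ σ → L′ σ ℕ.+ (lo ℕ.+ m) ℕ.+ (hi ℕ.∸ lo) ≡ hi ℕ.+ L′ σ ℕ.+ m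
        high σ = trans (shuffle (L′ σ) lo m (hi ℕ.∸ lo)) (cong (λ h → h ℕ.+ L′ σ ℕ.+ m) (ℕ.m+[n∸m]≡n lo≤hi))

  module ComponentColourings where
    open import Data.Fin.Properties using (_≟_)
    open import Data.Bool.Properties using (xor-assoc; xor-comm)
    open import Data.Vec.Properties using (lookup∘update; lookup∘update′)
    open import Data.Nat.Tactic.RingSolver using () renaming (solve-∀ to solve-∀ℕ)
    open CubeDivisibility
    open Tallies using (δ)

    -- The colourings consistent with the answers so far: the comparisons have split the balls into
    -- components g whose members have known colours relative to each other, recorded by h.
    colouring : ∀ {m k} → (Fin m → Fin k) → (Fin m → Bool) → Vec Bool k → Colouring m
    colouring g h σ i = lookup σ (g i) xor h i

    componentWeight : ∀ {m k} → (Fin m → Fin k) → (Fin m → Bool) → Fin k → Bool → ℕ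
    componentWeight {zero}  g h j v = 0
    componentWeight {suc m} g h j v =
      (if does (g fzero ≟ j) then δ (v xor h fzero) true else 0) ℕ.+ componentWeight (g ∘ fsuc) (h ∘ fsuc) j v

    linearForm-zero : ∀ {k} (σ : Vec Bool k) → linearForm (λ _ _ → 0) σ ≡ 0
    linearForm-zero []      = refl
    linearForm-zero (x ∷ σ) = linearForm-zero σ

    linearForm-+ : ∀ {k} (u w : Fin k → Bool → ℕ) σ → linearForm (λ j v → u j v ℕ.+ w j v) σ ≡ linearForm u σ ℕ.+ linearForm w σ
    linearForm-+ u w []      = refl
    linearForm-+ u w (x ∷ σ) = trans (cong (u fzero x ℕ.+ w fzero x ℕ.+_) (linearForm-+ (u ∘ fsuc) (w ∘ fsuc) σ))
                                     (interchange (u fzero x) (w fzero x) _ _)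
      where
      interchange : ∀ a b c d → a ℕ.+ b ℕ.+ (c ℕ.+ d) ≡ a ℕ.+ c ℕ.+ (b ℕ.+ d)
      interchange = solve-∀ℕ

    linearForm-point : ∀ {k} p (e : Bool → ℕ) (σ : Vec Bool k) → linearForm (λ j v → if does (p ≟ j) then e v else 0) σ ≡ e (lookup σ p)
    linearForm-point fzero    e (x ∷ σ) = trans (cong (e x ℕ.+_) (linearForm-zero σ)) (ℕ.+-identityʳ (e x))
    linearForm-point (fsuc p) e (x ∷ σ) = linearForm-point p e σ

    count-colouring : ∀ {m k} (g : Fin m → Fin k) h σ → count (colouring g h σ) true ≡ linearForm (componentWeight g h) σ
    count-colouring {zero}  g h σ = sym (linearForm-zero σ)
    count-colouring {suc m} g h σ = sym (begin
      linearForm (componentWeight g h) σ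
        ≡⟨ linearForm-+ (λ j v → if does (g fzero ≟ j) then δ (v xor h fzero) true else 0) (componentWeight (g ∘ fsuc) (h ∘ fsuc)) σ ⟩
      linearForm (λ j v → if does (g fzero ≟ j) then δ (v xor h fzero) true else 0) σ ℕ.+ linearForm (componentWeight (g ∘ fsuc) (h ∘ fsuc)) σ
        ≡⟨ cong₂ ℕ._+_ (linearForm-point (g fzero) (λ v → δ (v xor h fzero) true) σ) (sym (count-colouring (g ∘ fsuc) (h ∘ fsuc) σ)) ⟩
      count (colouring g h σ) true
        ∎)
      where open ≡-Reasoning

    freeze : ∀ {k} → Fin k → Bool → (Fin k → Bool → ℕ) → Fin k → Bool → ℕ
    freeze j v w i b = if does (i ≟ j) then w j v else w i b

    linearForm-update : ∀ {k} j v (w : Fin k → Bool → ℕ) σ → linearForm w (σ [ j ]≔ v) ≡ linearForm (freeze j v w) σ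
    linearForm-update fzero    v w (x ∷ σ) = refl
    linearForm-update (fsuc j) v w (x ∷ σ) = cong (w fzero x ℕ.+_) (linearForm-update j v (w ∘ fsuc) σ)

    merge : ∀ {m k} → Fin k → Fin k → (Fin m → Fin k) → Fin m → Fin k
    merge ci cj g l = if does (g l ≟ cj) then ci else g l

    mergeOffsets : ∀ {m k} → Fin k → (Fin m → Fin k) → (Fin m → Bool) → Bool → Fin m → Bool
    mergeOffsets cj g h τ l = if does (g l ≟ cj) then h l xor τ else h l

    colouring-merge : ∀ {m k} (g : Fin m → Fin k) h ci cj τ σ l →
      colouring g h (σ [ cj ]≔ (lookup σ ci xor τ)) l ≡ colouring (merge ci cj g) (mergeOffsets cj g h τ) σ l
    colouring-merge g h ci cj τ σ l with g l ≟ cj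
    ... | yes refl = trans (cong (_xor h l) (lookup∘update cj σ _))
                           (trans (xor-assoc (lookup σ ci) τ (h l)) (cong (lookup σ ci xor_) (xor-comm τ (h l))))
    ... | no gl≢cj = cong (_xor h l) (lookup∘update′ gl≢cj σ _)

  module Invariant {n : ℕ} (f : ℕ → ℤ) (t : ℕ) (f-poly : AlternatingPolynomials.AltPoly≤ t f) where
    open import Data.Fin.Properties using (_≟_)
    open import Data.Bool.Properties
      using (xor-same; xor-assoc; xor-identityʳ; not-distribˡ-xor; not-distribʳ-xor; not-¬) renaming (_≟_ to _≟ᵇ_)
    open import Data.Vec.Properties using (lookup∘update; lookup∘update′)
    open BooleanCube
    open CubeDivisibility
    open ComponentColourings

    run-cong : ∀ (s : Strategy n) {c c′ : Colouring n} → (∀ i → c i ≡ c′ i) → run s c ≡ run s c′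
    run-cong (answer x)          c≗c′ = refl
    run-cong (compare i j s₁ s₂) {c} {c′} c≗c′ rewrite c≗c′ i | c≗c′ j with does (c′ i ≟ᵇ c′ j)
    ... | true  = run-cong s₁ c≗c′
    ... | false = run-cong s₂ c≗c′

    count-cong : ∀ {m} {c c′ : Colouring m} b → (∀ i → c i ≡ c′ i) → count c b ≡ count c′ b
    count-cong {zero}  b c≗c′ = refl
    count-cong {suc m} b c≗c′ rewrite c≗c′ fzero = cong (_ ℕ.+_) (count-cong b (c≗c′ ∘ fsuc))

    penalty : Strategy n → Colouring n → ℤ
    penalty s c = if c (run s c) then 0ℤ else f (count c true)

    penalty-cong : ∀ s {c c′} → (∀ i → c i ≡ c′ i) → penalty s c ≡ penalty s c′
    penalty-cong s {c} {c′} c≗c′ rewrite run-cong s c≗c′ | c≗c′ (run s c′) | count-cong true c≗c′ = refl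

    penalty-compare : ∀ i j s₁ s₂ c → penalty (compare i j s₁ s₂) c ≡ (if does (c i ≟ᵇ c j) then penalty s₁ c else penalty s₂ c)
    penalty-compare i j s₁ s₂ c with does (c i ≟ᵇ c j)
    ... | true  = refl
    ... | false = refl

    not-xor-self : ∀ b → not b xor b ≡ true
    not-xor-self true  = refl
    not-xor-self false = refl

    penaltySum : Strategy n → (Fin n → Fin n) → (Fin n → Bool) → ℤ
    penaltySum s g h = sumCube n (λ σ → penalty s (colouring g h σ))

    leafExponent : ℕ
    leafExponent = n ℕ.∸ t ℕ.∸ 1

    -- Exactly one of σ and its flip at g x makes x false; the surviving term is f of a linear form.
    answer-divisible : ∀ x g h → 2^ leafExponent ∣ penaltySum (answer x) g h
    answer-divisible x g h =
      2^-∣-halve-pred (n ℕ.∸ t) (subst (_ ∣_) (sym twice) (sumCube-AltPoly-divisible n (freeze j (h x) W) t f f-poly 0))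
      where
      j = g x
      W = componentWeight g h
      G : Vec Bool n → ℤ
      G σ = penalty (answer x) (colouring g h σ)
      x-false : ∀ σ → G (σ [ j ]≔ h x) ≡ f (linearForm (freeze j (h x) W) σ ℕ.+ 0)
      x-false σ rewrite lookup∘update j σ (h x) | xor-same (h x) =
        cong f (trans (count-colouring g h (σ [ j ]≔ h x)) (trans (linearForm-update j (h x) W σ) (sym (ℕ.+-identityʳ _))))
      x-true : ∀ σ → G (σ [ j ]≔ not (h x)) ≡ 0ℤ
      x-true σ rewrite lookup∘update j σ (not (h x)) | not-xor-self (h x) = refl
      twice : sumCube n G + sumCube n G ≡ sumCube n (λ σ → f (linearForm (freeze j (h x) W) σ ℕ.+ 0))
      twice = trans (sumCube-double n j G) (sumCube-cong n λ σ →
        trans (flip-pair j (h x) σ G) (trans (cong₂ _+_ (x-false σ) (x-true σ)) (ℤ.+-identityʳ _)))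

    private
      shallower₁ : ∀ (s₁ s₂ : Strategy n) → leafExponent ℕ.∸ suc (depth s₁ ℕ.⊔ depth s₂) ≤ leafExponent ℕ.∸ depth s₁
      shallower₁ s₁ s₂ = ℕ.∸-monoʳ-≤ leafExponent (ℕ.m≤n⇒m≤1+n (ℕ.m≤m⊔n (depth s₁) (depth s₂)))

      shallower₂ : ∀ (s₁ s₂ : Strategy n) → leafExponent ℕ.∸ suc (depth s₁ ℕ.⊔ depth s₂) ≤ leafExponent ℕ.∸ depth s₂
      shallower₂ s₁ s₂ = ℕ.∸-monoʳ-≤ leafExponent (ℕ.m≤n⇒m≤1+n (ℕ.m≤n⊔m (depth s₁) (depth s₂)))

      xor-≟ : ∀ y a b → does ((y xor a) ≟ᵇ (y xor b)) ≡ does (a ≟ᵇ b)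
      xor-≟ false a     b     = refl
      xor-≟ true  true  true  = refl
      xor-≟ true  true  false = refl
      xor-≟ true  false true  = refl
      xor-≟ true  false false = refl

      xor-cancelʳ : ∀ y a b → (y xor (a xor b)) xor b ≡ y xor a
      xor-cancelʳ y a b = begin
        (y xor (a xor b)) xor b  ≡⟨ xor-assoc y (a xor b) b ⟩
        y xor ((a xor b) xor b)  ≡⟨ cong (y xor_) (xor-assoc a b b) ⟩
        y xor (a xor (b xor b))  ≡⟨ cong (λ z → y xor (a xor z)) (xor-same b) ⟩
        y xor (a xor false)      ≡⟨ cong (y xor_) (xor-identityʳ a) ⟩
        y xor a                  ∎
        where open ≡-Reasoning

      realigned : ∀ y a b → does ((y xor a) ≟ᵇ ((y xor (a xor b)) xor b)) ≡ true
      realigned y a b = dec-true ((y xor a) ≟ᵇ ((y xor (a xor b)) xor b)) (sym (xor-cancelʳ y a b))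

      misaligned : ∀ y a b → does ((y xor a) ≟ᵇ ((y xor not (a xor b)) xor b)) ≡ false
      misaligned y a b = dec-false ((y xor a) ≟ᵇ ((y xor not (a xor b)) xor b)) λ eq → not-¬ refl (trans eq (begin
        (y xor not (a xor b)) xor b  ≡⟨ cong (_xor b) (not-distribʳ-xor y (a xor b)) ⟨
        not (y xor (a xor b)) xor b  ≡⟨ not-distribˡ-xor (y xor (a xor b)) b ⟨
        not ((y xor (a xor b)) xor b) ≡⟨ cong not (xor-cancelʳ y a b) ⟩
        not (y xor a)                ∎))
        where open ≡-Reasoning

    -- Both balls lie in one component, so the answer to the comparison is the same for every σ.
    compare-same-component : ∀ i j s₁ s₂ g h → g i ≡ g j →
      2^ (leafExponent ℕ.∸ depth s₁) ∣ penaltySum s₁ g h → 2^ (leafExponent ℕ.∸ depth s₂) ∣ penaltySum s₂ g h →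
      2^ (leafExponent ℕ.∸ depth (compare i j s₁ s₂)) ∣ penaltySum (compare i j s₁ s₂) g h
    compare-same-component i j s₁ s₂ g h gi≡gj ∣Σ₁ ∣Σ₂ = subst (_ ∣_) (sym outcome) (chosen (does (h i ≟ᵇ h j)))
      where
      P : Bool → Vec Bool n → ℤ
      P b σ = if b then penalty s₁ (colouring g h σ) else penalty s₂ (colouring g h σ)
      outcome : penaltySum (compare i j s₁ s₂) g h ≡ sumCube n (P (does (h i ≟ᵇ h j)))
      outcome = sumCube-cong n λ σ → trans (penalty-compare i j s₁ s₂ (colouring g h σ))
        (cong (λ b → P b σ) (trans (cong (λ c → does ((lookup σ (g i) xor h i) ≟ᵇ (lookup σ c xor h j))) (sym gi≡gj))
                                   (xor-≟ (lookup σ (g i)) (h i) (h j))))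
      chosen : ∀ b → 2^ (leafExponent ℕ.∸ depth (compare i j s₁ s₂)) ∣ sumCube n (P b)
      chosen true  = 2^-∣-≤ (shallower₁ s₁ s₂) ∣Σ₁
      chosen false = 2^-∣-≤ (shallower₂ s₁ s₂) ∣Σ₂

    -- Pairing σ with its flip at g j, exactly one of the two makes balls i and j look alike; fixing
    -- that coordinate merges the component of j into that of i.
    compare-merge : ∀ i j s₁ s₂ g h → g i ≢ g j →
      (∀ g′ h′ → 2^ (leafExponent ℕ.∸ depth s₁) ∣ penaltySum s₁ g′ h′) →
      (∀ g′ h′ → 2^ (leafExponent ℕ.∸ depth s₂) ∣ penaltySum s₂ g′ h′) →
      2^ (leafExponent ℕ.∸ depth (compare i j s₁ s₂)) ∣ penaltySum (compare i j s₁ s₂) g h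
    compare-merge i j s₁ s₂ g h gi≢gj ∣Σ₁ ∣Σ₂ =
      subst (λ e → 2^ e ∣ sumCube n G) exponent $
      2^-∣-halve-pred (leafExponent ℕ.∸ d) $ subst (_ ∣_) (sym twice) $
      ∣m∣n⇒∣m+n (2^-∣-≤ (ℕ.∸-monoʳ-≤ leafExponent (ℕ.m≤m⊔n (depth s₁) (depth s₂))) (∣Σ₁ g′ h₁))
                (2^-∣-≤ (ℕ.∸-monoʳ-≤ leafExponent (ℕ.m≤n⊔m (depth s₁) (depth s₂))) (∣Σ₂ g′ h₂))
      where
      d = depth s₁ ℕ.⊔ depth s₂
      ci = g i
      cj = g j
      τ = h i xor h j
      g′ = merge ci cj g
      h₁ = mergeOffsets cj g h τ
      h₂ = mergeOffsets cj g h (not τ)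
      G : Vec Bool n → ℤ
      G σ = penalty (compare i j s₁ s₂) (colouring g h σ)
      exponent : leafExponent ℕ.∸ d ℕ.∸ 1 ≡ leafExponent ℕ.∸ suc d
      exponent = trans (ℕ.∸-+-assoc leafExponent d 1) (cong (leafExponent ℕ.∸_) (ℕ.+-comm d 1))
      choice : Vec Bool n → Bool → ℤ
      choice σ′ same = if same then penalty s₁ (colouring g h σ′) else penalty s₂ (colouring g h σ′)
      fixed : ∀ σ b → G (σ [ cj ]≔ b) ≡ choice (σ [ cj ]≔ b) (does ((lookup σ ci xor h i) ≟ᵇ (b xor h j)))
      fixed σ b rewrite penalty-compare i j s₁ s₂ (colouring g h (σ [ cj ]≔ b)) | lookup∘update′ gi≢gj σ b | lookup∘update cj σ b = refl
      agree : ∀ σ → G (σ [ cj ]≔ (lookup σ ci xor τ)) ≡ penalty s₁ (colouring g′ h₁ σ)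
      agree σ = trans (fixed σ (lookup σ ci xor τ)) (trans (cong (choice (σ [ cj ]≔ (lookup σ ci xor τ))) (realigned (lookup σ ci) (h i) (h j)))
                                         (penalty-cong s₁ (colouring-merge g h ci cj τ σ)))
      disagree : ∀ σ → G (σ [ cj ]≔ not (lookup σ ci xor τ)) ≡ penalty s₂ (colouring g′ h₂ σ)
      disagree σ = trans (cong (λ b → G (σ [ cj ]≔ b)) (not-distribʳ-xor (lookup σ ci) τ))
        (trans (fixed σ (lookup σ ci xor not τ)) (trans (cong (choice (σ [ cj ]≔ (lookup σ ci xor not τ))) (misaligned (lookup σ ci) (h i) (h j)))
                                  (penalty-cong s₂ (colouring-merge g h ci cj (not τ) σ))))
      twice : sumCube n G + sumCube n G ≡ penaltySum s₁ g′ h₁ + penaltySum s₂ g′ h₂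
      twice = trans (sumCube-double n cj G) (trans
        (sumCube-cong n λ σ → trans (flip-pair cj (lookup σ ci xor τ) σ G) (cong₂ _+_ (agree σ) (disagree σ)))
        (sumCube-+ n (λ σ → penalty s₁ (colouring g′ h₁ σ)) (λ σ → penalty s₂ (colouring g′ h₂ σ))))

    invariant : ∀ s g h → 2^ (leafExponent ℕ.∸ depth s) ∣ penaltySum s g h
    invariant (answer x)          g h = answer-divisible x g h
    invariant (compare i j s₁ s₂) g h with g i ≟ g j
    ... | yes gi≡gj = compare-same-component i j s₁ s₂ g h gi≡gj (invariant s₁ g h) (invariant s₂ g h)
    ... | no  gi≢gj = compare-merge i j s₁ s₂ g h gi≢gj (invariant s₁) (invariant s₂)

  module BinomialSums where
    open import Data.Nat.Combinatorics using (_C_; k>n⇒nCk≡0; nCk+nC[k+1]≡[n+1]C[k+1]; nCn≡1)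
    open GeneralisedBinomial
    open AlternatingPolynomials
    open BooleanCube

    sumUpTo : ℕ → (ℕ → ℤ) → ℤ
    sumUpTo zero    F = F 0
    sumUpTo (suc N) F = sumUpTo N F + F (suc N)

    sumUpTo-cong : ∀ N {F G} → (∀ j → j ≤ N → F j ≡ G j) → sumUpTo N F ≡ sumUpTo N G
    sumUpTo-cong zero    F≗G = F≗G 0 z≤n
    sumUpTo-cong (suc N) F≗G = cong₂ _+_ (sumUpTo-cong N λ j j≤N → F≗G j (ℕ.m≤n⇒m≤1+n j≤N)) (F≗G (suc N) ℕ.≤-refl)

    sumUpTo-+ : ∀ N F G → sumUpTo N (λ j → F j + G j) ≡ sumUpTo N F + sumUpTo N G
    sumUpTo-+ zero    F G = refl
    sumUpTo-+ (suc N) F G = trans (cong (_+ (F (suc N) + G (suc N))) (sumUpTo-+ N F G)) (interchange (sumUpTo N F) (sumUpTo N G) (F (suc N)) (G (suc N)))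
      where
      interchange : ∀ a b c d → a + b + (c + d) ≡ a + c + (b + d)
      interchange = solve-∀

    sumUpTo-neg : ∀ N F → sumUpTo N (λ j → - F j) ≡ - sumUpTo N F
    sumUpTo-neg zero    F = refl
    sumUpTo-neg (suc N) F = trans (cong (_+ - F (suc N)) (sumUpTo-neg N F)) (sym (ℤ.neg-distrib-+ (sumUpTo N F) (F (suc N))))

    sumUpTo-suc : ∀ N F → sumUpTo (suc N) F ≡ F 0 + sumUpTo N (F ∘ suc)
    sumUpTo-suc zero    F = refl
    sumUpTo-suc (suc N) F = trans (cong (_+ F (suc (suc N))) (sumUpTo-suc N F)) (ℤ.+-assoc (F 0) _ _)

    sumUpTo-truncate : ∀ q N F → q ≤ N → (∀ j → q < j → F j ≡ 0ℤ) → sumUpTo N F ≡ sumUpTo q F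
    sumUpTo-truncate q zero    F z≤n _ = refl
    sumUpTo-truncate q (suc N) F q≤ vanish with ℕ.m≤n⇒m<n∨m≡n q≤
    ... | inj₂ refl = refl
    ... | inj₁ q<   = trans (cong (λ z → sumUpTo N F + z) (vanish (suc N) q<))
                            (trans (ℤ.+-identityʳ _) (sumUpTo-truncate q N F (ℕ.≤-pred q<) vanish))

    trues : ∀ {n} → Vec Bool n → ℕ
    trues σ = count (lookup σ) true

    sumCube-trues : ∀ n G → sumCube n (G ∘ trues) ≡ sumUpTo n (λ j → + (n C j) * G j)
    sumCube-trues zero    G = sym (ℤ.*-identityˡ (G 0))
    sumCube-trues (suc n) G = begin
      sumCube n (G ∘ trues) + sumCube n (G ∘ suc ∘ trues) ≡⟨ cong₂ _+_ (sumCube-trues n G) (sumCube-trues n (G ∘ suc)) ⟩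
      X + Y                                               ≡⟨ cong (_+ Y) X≡ ⟩
      1ℤ * G 0 + Z + Y                                    ≡⟨ swap (1ℤ * G 0) Z Y ⟩
      1ℤ * G 0 + (Y + Z)                                  ≡⟨ cong (λ s → 1ℤ * G 0 + s) (sumUpTo-+ n y z) ⟨
      1ℤ * G 0 + sumUpTo n (λ j → + (n C j) * G (suc j) + + (n C suc j) * G (suc j))
                                                          ≡⟨ cong (λ s → 1ℤ * G 0 + s) (sumUpTo-cong n λ j _ → pascal-term j) ⟩
      1ℤ * G 0 + sumUpTo n (λ j → + (suc n C suc j) * G (suc j))
                                                          ≡⟨ sumUpTo-suc n (λ j → + (suc n C j) * G j) ⟨
      sumUpTo (suc n) (λ j → + (suc n C j) * G j)         ∎
      where
      open ≡-Reasoning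
      y z : ℕ → ℤ
      y j = + (n C j) * G (suc j)
      z j = + (n C suc j) * G (suc j)
      X = sumUpTo n (λ j → + (n C j) * G j)
      Y = sumUpTo n y
      Z = sumUpTo n z
      X≡ : X ≡ 1ℤ * G 0 + Z
      X≡ = begin
        X                                                ≡⟨ ℤ.+-identityʳ X ⟨
        X + 0ℤ * G (suc n)                               ≡⟨ cong (λ c → X + + c * G (suc n)) (k>n⇒nCk≡0 (ℕ.n<1+n n)) ⟨
        sumUpTo (suc n) (λ j → + (n C j) * G j)          ≡⟨ sumUpTo-suc n (λ j → + (n C j) * G j) ⟩
        1ℤ * G 0 + Z                                     ∎
      swap : ∀ a z y → a + z + y ≡ a + (y + z)
      swap = solve-∀
      pascal-term : ∀ j → + (n C j) * G (suc j) + + (n C suc j) * G (suc j) ≡ + (suc n C suc j) * G (suc j)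
      pascal-term j = trans (sym (ℤ.*-distribʳ-+ (G (suc j)) (+ (n C j)) (+ (n C suc j)))) (cong (λ c → + c * G (suc j)) (nCk+nC[k+1]≡[n+1]C[k+1] n j))

    weight-pascal : ∀ q t j → weight (suc q) (suc t) j ≡ weight q (suc t) j - weight (suc q) t j
    weight-pascal q t j = begin
      a * binomial y (suc t)                               ≡⟨ telescope a (binomial y (suc t)) (binomial y t) ⟩
      a * (binomial y (suc t) + binomial y t) - a * binomial y t ≡⟨ cong (λ b → a * b - a * binomial y t) (binomial-pascal y t) ⟨
      a * binomial (sucℤ y) (suc t) - a * binomial y t     ≡⟨ cong (λ x → a * binomial x (suc t) - a * binomial y t) y+1≡ ⟩
      a * binomial (j ⊖ suc q) (suc t) - a * binomial y t  ∎
      where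
      open ≡-Reasoning
      a = -1ℤ ^ j
      y = j ⊖ suc (suc q)
      y+1≡ : sucℤ y ≡ j ⊖ suc q
      y+1≡ = trans (ℤ.distribʳ-⊖-+-pos 1 j (suc (suc q))) (ℤ.[1+m]⊖[1+n]≡m⊖n j (suc q))
      telescope : ∀ a x y → a * x ≡ a * (x + y) - a * y
      telescope = solve-∀

    weightedPrefixSum : ℕ → ℕ → ℕ → ℤ
    weightedPrefixSum M t q = sumUpTo q (λ j → + (M C j) * weight q t j)

    weightedPrefixSum-step : ∀ M t q →
      weightedPrefixSum M (suc t) (suc q) ≡ weightedPrefixSum M (suc t) q - weightedPrefixSum M t (suc q)
    weightedPrefixSum-step M t q = begin
      sumUpTo (suc q) (λ j → + (M C j) * weight (suc q) (suc t) j)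
        ≡⟨ sumUpTo-cong (suc q) (λ j _ → trans (cong (+ (M C j) *_) (weight-pascal q t j)) (ℤ.*-distribˡ-+ (+ (M C j)) _ _)) ⟩
      sumUpTo (suc q) (λ j → + (M C j) * weight q (suc t) j + + (M C j) * - weight (suc q) t j)
        ≡⟨ sumUpTo-+ (suc q) (λ j → + (M C j) * weight q (suc t) j) _ ⟩
      weightedPrefixSum M (suc t) q + + (M C suc q) * weight q (suc t) (suc q) + sumUpTo (suc q) (λ j → + (M C j) * - weight (suc q) t j)
        ≡⟨ cong₂ _+_ lower upper ⟩
      weightedPrefixSum M (suc t) q - weightedPrefixSum M t (suc q)
        ∎
      where
      open ≡-Reasoning
      top-vanishes : weight q (suc t) (suc q) ≡ 0ℤ
      top-vanishes = trans (cong (λ y → -1ℤ ^ suc q * binomial y (suc t)) (ℤ.n⊖n≡0 (suc q))) (ℤ.*-zeroʳ (-1ℤ ^ suc q))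
      lower : weightedPrefixSum M (suc t) q + + (M C suc q) * weight q (suc t) (suc q) ≡ weightedPrefixSum M (suc t) q
      lower = trans (cong (λ w → weightedPrefixSum M (suc t) q + + (M C suc q) * w) top-vanishes)
                    (trans (cong (λ z → weightedPrefixSum M (suc t) q + z) (ℤ.*-zeroʳ (+ (M C suc q)))) (ℤ.+-identityʳ _))
      upper : sumUpTo (suc q) (λ j → + (M C j) * - weight (suc q) t j) ≡ - weightedPrefixSum M t (suc q)
      upper = trans (sumUpTo-cong (suc q) λ j _ → sym (ℤ.neg-distribʳ-* (+ (M C j)) (weight (suc q) t j)))
                    (sumUpTo-neg (suc q) (λ j → + (M C j) * weight (suc q) t j))

    alternating-row-sum : ∀ N q → sumUpTo q (λ j → + (suc N C j) * (-1ℤ ^ j * 1ℤ)) ≡ -1ℤ ^ q * + (N C q)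
    alternating-row-sum N zero    = refl
    alternating-row-sum N (suc q) = begin
      sumUpTo q (λ j → + (suc N C j) * (-1ℤ ^ j * 1ℤ)) + + (suc N C suc q) * (-1ℤ * -1ℤ ^ q * 1ℤ)
        ≡⟨ cong₂ (λ s c → s + + c * (-1ℤ * -1ℤ ^ q * 1ℤ)) (alternating-row-sum N q) (sym (nCk+nC[k+1]≡[n+1]C[k+1] N q)) ⟩
      -1ℤ ^ q * + (N C q) + (+ (N C q) + + (N C suc q)) * (-1ℤ * -1ℤ ^ q * 1ℤ)
        ≡⟨ cancel (-1ℤ ^ q) (+ (N C q)) (+ (N C suc q)) ⟩
      -1ℤ * -1ℤ ^ q * + (N C suc q)
        ∎
      where
      open ≡-Reasoning
      cancel : ∀ a x y → a * x + (x + y) * (-1ℤ * a * 1ℤ) ≡ -1ℤ * a * y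
      cancel = solve-∀

    weightedPrefixSum-t0 : ∀ N q → weightedPrefixSum (suc N) 0 q ≡ -1ℤ ^ q * + (N C q)
    weightedPrefixSum-t0 N q = trans
      (sumUpTo-cong q λ j _ → cong (λ b → + (suc N C j) * (-1ℤ ^ j * b)) (binomial-zero (j ⊖ suc q)))
      (alternating-row-sum N q)

    weightedPrefixSum-q0 : ∀ M t → weightedPrefixSum M t 0 ≡ -1ℤ ^ t
    weightedPrefixSum-q0 M t = trans (cong (λ c → 1ℤ * (1ℤ * (-1ℤ ^ t * + c))) (nCn≡1 t)) (unit (-1ℤ ^ t))
      where
      unit : ∀ a → 1ℤ * (1ℤ * (a * 1ℤ)) ≡ a
      unit = solve-∀

    weightedPrefixSum-value : ∀ t N q → weightedPrefixSum (suc (t ℕ.+ N)) t q ≡ -1ℤ ^ (q ℕ.+ t) * + (N C q)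
    weightedPrefixSum-value zero    N q = trans (weightedPrefixSum-t0 N q) (cong (λ e → -1ℤ ^ e * + (N C q)) (sym (ℕ.+-identityʳ q)))
    weightedPrefixSum-value (suc t) N zero = trans (weightedPrefixSum-q0 (suc (suc t ℕ.+ N)) (suc t)) (sym (ℤ.*-identityʳ (-1ℤ ^ suc t)))
    weightedPrefixSum-value (suc t) N (suc q) = begin
      weightedPrefixSum M (suc t) (suc q)
        ≡⟨ weightedPrefixSum-step M t q ⟩
      weightedPrefixSum M (suc t) q - weightedPrefixSum M t (suc q)
        ≡⟨ cong₂ _-_ (weightedPrefixSum-value (suc t) N q)
                     (trans (cong (λ m → weightedPrefixSum (suc m) t (suc q)) (sym (ℕ.+-suc t N))) (weightedPrefixSum-value t (suc N) (suc q))) ⟩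
      -1ℤ ^ (q ℕ.+ suc t) * + (N C q) - -1ℤ ^ (suc q ℕ.+ t) * + (suc N C suc q)
        ≡⟨ cong₂ (λ e c → -1ℤ ^ e * + (N C q) - -1ℤ ^ suc (q ℕ.+ t) * + c) (sym (ℕ.+-suc q t)) (nCk+nC[k+1]≡[n+1]C[k+1] N q) ⟨
      -1ℤ * a * + (N C q) - -1ℤ * a * (+ (N C q) + + (N C suc q))
        ≡⟨ cancel a (+ (N C q)) (+ (N C suc q)) ⟩
      -1ℤ * (-1ℤ * a) * + (N C suc q)
        ≡⟨ cong (λ e → -1ℤ ^ e * + (N C suc q)) (cong suc (ℕ.+-suc q t)) ⟨
      -1ℤ ^ (suc q ℕ.+ suc t) * + (N C suc q)
        ∎
      where
      open ≡-Reasoning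
      M = suc (suc t ℕ.+ N)
      a = -1ℤ ^ (q ℕ.+ t)
      cancel : ∀ a x y → -1ℤ * a * x - -1ℤ * a * (x + y) ≡ -1ℤ * (-1ℤ * a) * y
      cancel = solve-∀

  module _ {n k : ℕ} (n<2k : n < 2 ℕ.* k) (k≤n : k ≤ n) where
    open import Data.Nat.Combinatorics using (_C_)
    open import Data.Bool.Properties using (xor-identityʳ)
    open import Data.Nat.Tactic.RingSolver using () renaming (solve-∀ to solve-∀ℕ)
    open MajorityRegime n<2k k≤n
    open AlternatingPolynomials
    open BooleanCube
    open BinomialSums
    open ComponentColourings using (colouring)
    open TwoAdicValuation using (∣-val₂)
    open CentralBinomial using (val₂-central-binomial)
    open Tallies using (count-complement)

    t : ℕ
    t = k ℕ.∸ suc q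

    k≡ : suc q ℕ.+ t ≡ k
    k≡ = ℕ.m+[n∸m]≡n q<k

    n≡ : n ≡ suc (t ℕ.+ (q ℕ.+ q))
    n≡ = trans (sym q+k≡n) (trans (cong (q ℕ.+_) (sym k≡)) (shuffle q t))
      where
      shuffle : ∀ q t → q ℕ.+ (suc q ℕ.+ t) ≡ suc (t ℕ.+ (q ℕ.+ q))
      shuffle = solve-∀ℕ

    leafExponent≡ : n ℕ.∸ t ℕ.∸ 1 ≡ q ℕ.+ q
    leafExponent≡ = cong (ℕ._∸ 1) (trans (cong (ℕ._∸ t) (trans n≡ (sym (ℕ.+-suc t _)))) (ℕ.m+n∸m≡n t _))

    f : ℕ → ℤ
    f = weight q t

    open Invariant {n} f t (weight-AltPoly≤ q t)

    truncated : ℕ → ℤ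
    truncated r = if does (r ℕ.≤? q) then f r else 0ℤ

    truncated-≤ : ∀ {r} → r ≤ q → truncated r ≡ f r
    truncated-≤ {r} r≤q = cong (if_then f r else 0ℤ) (dec-true (r ℕ.≤? q) r≤q)

    truncated-> : ∀ {r} → ¬ r ≤ q → truncated r ≡ 0ℤ
    truncated-> {r} r≰q = cong (if_then f r else 0ℤ) (dec-false (r ℕ.≤? q) r≰q)

    -- A winning strategy announces a true ball when at least k balls are true and a false one when
    -- at most q are; in between, f vanishes.
    penalty-winning : ∀ s → Wins k s → ∀ c → penalty s c ≡ truncated (count c true)
    penalty-winning s wins c with count c true ℕ.≤? q | c (run s c) in announced
    ... | yes r≤q | false = sym (truncated-≤ r≤q)
    ... | yes r≤q | true  = contradiction (ℕ.≤-trans announced-true r≤q) (ℕ.<⇒≱ q<k)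
      where
      k≤false : k ≤ count c false
      k≤false = ℕ.+-cancelˡ-≤ q k _ (begin
        q ℕ.+ k                           ≡⟨ q+k≡n ⟩
        n                                 ≡⟨ count-complement c true ⟨
        count c true ℕ.+ count c false    ≤⟨ ℕ.+-monoˡ-≤ (count c false) r≤q ⟩
        q ℕ.+ count c false               ∎)
        where open ℕ.≤-Reasoning
      announced-true : k ≤ count c true
      announced-true = subst (λ b → k ≤ count c b) announced (wins c (inj₂ k≤false))
    ... | no r≰q | true  = sym (truncated-> r≰q)
    ... | no r≰q | false with k ℕ.≤? count c true
    ...   | no  r≱k = trans (weight-vanishes q t (ℕ.≰⇒> r≰q) (subst (count c true <_) (sym k≡) (ℕ.≰⇒> r≱k))) (sym (truncated-> r≰q))
    ...   | yes k≤r = contradiction (begin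
        2 ℕ.* k                          ≡⟨ cong (k ℕ.+_) (ℕ.+-identityʳ k) ⟩
        k ℕ.+ k                          ≤⟨ ℕ.+-mono-≤ k≤r (subst (λ b → k ≤ count c b) announced (wins c (inj₁ k≤r))) ⟩
        count c true ℕ.+ count c false   ≡⟨ count-complement c true ⟩
        n                                ∎) (ℕ.<⇒≱ n<2k)
        where open ℕ.≤-Reasoning

    root-value : ∀ s → Wins k s → penaltySum s id (λ _ → false) ≡ -1ℤ ^ (q ℕ.+ t) * + ((q ℕ.+ q) C q)
    root-value s wins = begin
      sumCube n (λ σ → penalty s (colouring id (λ _ → false) σ))
        ≡⟨ sumCube-cong n (λ σ → trans (penalty-cong s (xor-identityʳ ∘ lookup σ)) (penalty-winning s wins (lookup σ))) ⟩
      sumCube n (truncated ∘ trues)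
        ≡⟨ sumCube-trues n truncated ⟩
      sumUpTo n (λ j → + (n C j) * truncated j)
        ≡⟨ sumUpTo-truncate q n _ q≤n (λ j q<j → trans (cong (+ (n C j) *_) (truncated-> (ℕ.<⇒≱ q<j))) (ℤ.*-zeroʳ (+ (n C j)))) ⟩
      sumUpTo q (λ j → + (n C j) * truncated j)
        ≡⟨ sumUpTo-cong q (λ j j≤q → cong (+ (n C j) *_) (truncated-≤ j≤q)) ⟩
      weightedPrefixSum n t q
        ≡⟨ cong (λ m → weightedPrefixSum m t q) n≡ ⟩
      weightedPrefixSum (suc (t ℕ.+ (q ℕ.+ q))) t q
        ≡⟨ weightedPrefixSum-value t (q ℕ.+ q) q ⟩
      -1ℤ ^ (q ℕ.+ t) * + ((q ℕ.+ q) C q)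
        ∎
      where
      open ≡-Reasoning
      q≤n : q ≤ n
      q≤n = subst (q ≤_) q+k≡n (ℕ.m≤m+n q k)

    lower-bound : ∀ s → Wins k s → 2 ℕ.* q ℕ.∸ B q ≤ depth s
    lower-bound s wins = subst (λ m → m ℕ.∸ B q ≤ depth s) (cong (q ℕ.+_) (sym (ℕ.+-identityʳ q))) (swap-∸ exponent≤)
      where
      d = depth s
      central∣ : 2^ (q ℕ.+ q ℕ.∸ d) ∣ + ((q ℕ.+ q) C q)
      central∣ = subst₂ (λ e z → 2^ (e ℕ.∸ d) ∣ z) leafExponent≡ unsign (∣n⇒∣m*n (-1ℤ ^ (q ℕ.+ t)) root∣)
        where
        root∣ : 2^ (leafExponent ℕ.∸ d) ∣ -1ℤ ^ (q ℕ.+ t) * + ((q ℕ.+ q) C q)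
        root∣ = subst (2^ (leafExponent ℕ.∸ d) ∣_) (root-value s wins) (invariant s id (λ _ → false))
        unsign : -1ℤ ^ (q ℕ.+ t) * (-1ℤ ^ (q ℕ.+ t) * + ((q ℕ.+ q) C q)) ≡ + ((q ℕ.+ q) C q)
        unsign = trans (sym (ℤ.*-assoc (-1ℤ ^ (q ℕ.+ t)) _ _)) (trans (cong (_* + ((q ℕ.+ q) C q)) (-1^-square (q ℕ.+ t))) (ℤ.*-identityˡ _))
      exponent≤ : q ℕ.+ q ℕ.∸ d ≤ B q
      exponent≤ = ∣-val₂ (∣⇒∣ᵤ central∣) (val₂-central-binomial q)
      swap-∸ : ∀ {a b} → a ℕ.∸ d ≤ b → a ℕ.∸ b ≤ d
      swap-∸ {a} {b} a∸d≤b = ℕ.m≤n+o⇒m∸n≤o a b (ℕ.≤-trans (ℕ.m≤n+m∸n a d)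
        (subst (_≤ b ℕ.+ d) (ℕ.+-comm _ d) (ℕ.+-monoˡ-≤ d a∸d≤b)))

open import Data.Nat.Base using (_*_; _∸_)

theorem1 : (n k : ℕ) → n < 2 * k → k ≤ n →
    IsK n k (2 * (n ∸ k) ∸ B (n ∸ k))
theorem1 n k n<2k k≤n = UpperBound.upper-bound n k n<2k k≤n , LowerBound.lower-bound n<2k k≤n
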